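{- Fix integers $k \geq 1$, $j \geq 1$, $s \geq 0$, and a finite rooted ordered tree $\mathcal T$ of height $p \geq 2$, and let $\mathcal K$, $\mathcal K(n)$, $R(n)$, $N(i)$, $\mathcal P R(n)$, $\nu$ and $\Delta(n)$ be as in the context. For $n > N(p+1)$ the following hold. (1) If $n$ is neither a leaf label nor a penultimate label then $\mathcal K(n)$ is complete. Consequently, for every $n > N(p+1)$, $0 \leq \Delta(n) < (k+1)j$. (2) Suppose $\Delta(n) > 0$. Then $0 < \Delta(n) < kj$ if and only if $n$ is a leaf label, and $\Delta(n) \geq kj$ if and only if $n$ is a penultimate label. (3) If $0 \leq \Delta(n) \leq kj$ then $\mathcal P R(n) = \dfrac{R(n) + \Delta(n) - \nu}{k}$. (4) If $\Delta(n) > kj$ then $\mathcal P R(n) = \dfrac{R(n) + kj - \nu}{k} - \Delta(n) + kj$.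
   Context: Construction of $\mathcal K$. The children of each node of $\mathcal T$ are linearly ordered; the height of $\mathcal T$ is the length of a longest path from the root to a node. Build finite ordered rooted trees $\mathcal K_1, \mathcal K_2, \dots$: $\mathcal K_p$ is a copy of $\mathcal T$; for $2 \leq i < p$, $\mathcal K_i$ is a copy of $\mathcal K_{i+1}$ with all its leaves deleted; $\mathcal K_1$ is a copy of $\mathcal K_2$ with all its leaves deleted and with one extra node attached as the first child of its root; for $i > p$, $\mathcal K_i$ is a copy of $\mathcal K_{i-1}$ in which exactly $k$ new children are attached to each leaf. The root of $\mathcal K_i$ is the $i$-th supernode; other nodes are regular nodes. $\mathcal K$ consists of all $\mathcal K_i$ together with, for each $i \geq 1$, an edge from the $i$-th supernode to the $(i+1)$-st supernode (the $i$-th supernode being an additional child of the $(i+1)$-st). Traversal order: first the nodes of $\mathcal K_1$: the extra child, then the first supernode, then the remaining children of the first supernode in order; then for $i=2,3,\dots$ the nodes of $\mathcal K_i$ in the usual pre-order of $\mathcal K_i$. Labeling: each supernode receives $s$ labels, each regular node $j$ labels; labels are the consecutive positive integers assigned following the traversal order. A leaf of $\mathcal K$ is a node with no children in $\mathcal K$; a leaf label is a label in a leaf of $\mathcal K$. A penultimate node is a non-leaf node of $\mathcal K$ all of whose children are leaves of $\mathcal K$; its labels are penultimate labels. $R(n)$ is the number of leaf labels $\leq n$; $N(i)$ is the largest label in $\mathcal K_i$. $\alpha$ (resp. $\beta$) is the number of leaf labels (resp. penultimate labels) lying in $\mathcal K_1,\dots,\mathcal K_p$, and $\nu = \alpha -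 k(\beta - s + j)$. For $m \geq 1$, $\mathcal K(m)$ is the subtree of $\mathcal K$ consisting of all nodes up to and including (in traversal order) the node containing label $m$, carrying only the labels $1,\dots,m$. $\mathcal K(m)$ is complete if every penultimate node of $\mathcal K$ contained in $\mathcal K(m)$ has all of its children (in $\mathcal K$) contained in $\mathcal K(m)$, each of these children carrying all $j$ of its labels in $\mathcal K(m)$. $\Delta(n)$ is the least non-negative integer such that $\mathcal K(n+\Delta(n))$ is complete. Pruning: for $n > N(1)$, $\mathcal P\mathcal K(n)$ is obtained from $\mathcal K(n)$ by deleting every node that is a leaf of $\mathcal K$ (together with its labels), converting the first supernode into a regular node carrying $j$ labels, and relabeling all labels by $1,2,3,\dots$ in traversal order. A label of $\mathcal P\mathcal K(n)$ is a leaf label of $\mathcal P\mathcal K(n)$ if its node is a penultimate node of $\mathcal K$. $\mathcal P R(n)$ is the number of leaf labels of $\mathcal P\mathcal K(n)$. -}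

module Defs where

open import Data.Nat using (ℕ; zero; suc; _+_; _*_; _∸_; _≤ᵇ_; _⊔_; _⊓_)
open import Data.Bool using (Bool; true; false; not; _∧_; if_then_else_; T)
open import Data.List using (List; []; _∷_; _++_; map; length; replicate; concatMap; filter; null; upTo)
open import Data.Bool.ListAction using (all)
open import Data.Nat.ListAction using (sum)
open import Data.Maybe using (Maybe; just; nothing; maybe)
open import Data.Product using (_×_; _,_; proj₁; proj₂; ∃)
open import Data.List.Relation.Unary.All using (All)
open import Data.List.Membership.Propositional using (_∈_)
open import Data.Integer using (ℤ; +_; _-_) renaming (_*_ to _*ℤ_; _+_ to _+ℤ_)
open import Relation.Nullary using (¬_)
open import Function using (_∘_)
open import Data.Nat using (_<_)

data Tree : Set where
  node : List Tree → Tree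

rootKids : Tree → List Tree
rootKids (node ts) = ts

mutual
  height : Tree → ℕ
  height (node []) = 0
  height (node ts@(_ ∷ _)) = suc (heightL ts)

  heightL : List Tree → ℕ
  heightL [] = 0
  heightL (t ∷ ts) = height t ⊔ heightL ts

mutual
  dropLeaves : Tree → Tree
  dropLeaves (node ts) = node (dropLeavesL ts)

  dropLeavesL : List Tree → List Tree
  dropLeavesL [] = []
  dropLeavesL (node [] ∷ ts) = dropLeavesL ts
  dropLeavesL (node cs@(_ ∷ _) ∷ ts) = node (dropLeavesL cs) ∷ dropLeavesL ts

mutual
  grow : ℕ → Tree → Tree
  grow k (node []) = node (replicate k (node []))
  grow k (node ts@(_ ∷ _)) = node (growL k ts)

  growL : ℕ → List Tree → List Tree
  growL k [] = []
  growL k (t ∷ ts) = grow k t ∷ growL k ts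

iter : {A : Set} → (A → A) → ℕ → A → A
iter f zero x = x
iter f (suc n) x = f (iter f n x)

mutual
  subAt : Tree → List ℕ → Maybe Tree
  subAt t [] = just t
  subAt (node ts) (c ∷ cs) = subAtL ts c cs

  subAtL : List Tree → ℕ → List ℕ → Maybe Tree
  subAtL [] _ _ = nothing
  subAtL (t ∷ ts) zero cs = subAt t cs
  subAtL (t ∷ ts) (suc c) cs = subAtL ts c cs

mutual
  pathsT : List ℕ → Tree → List (List ℕ)
  pathsT p (node ts) = p ∷ pathsL p 0 ts

  pathsL : List ℕ → ℕ → List Tree → List (List ℕ)
  pathsL p c [] = []
  pathsL p c (t ∷ ts) = pathsT (p ++ (c ∷ [])) t ++ pathsL p (suc c) ts

nth : {A : Set} → List A → ℕ → Maybe A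
nth [] _ = nothing
nth (x ∷ xs) zero = just x
nth (x ∷ xs) (suc n) = nth xs n

-- Addresses of nodes of the infinite tree 𝒦:
--   sup i        : the i-th supernode (root of 𝒦_i), i ≥ 1
--   reg i path   : the regular node of 𝒦_i reached from its root by
--                  the (nonempty) list of 0-based child indices 'path'

data Addr : Set where
  sup : ℕ → Addr
  reg : ℕ → List ℕ → Addr

module Construction (k j s : ℕ) (𝒯 : Tree) where

  p : ℕ
  p = height 𝒯

  -- 𝒦_i without the extra node of 𝒦_1:
  --   i ≤ p : 𝒯 with leaves deleted (p - i) times
  --   i > p : 𝒯 with k children attached to each leaf (i - p) times
  base : ℕ → Tree
  base i = if i ≤ᵇ p then iter dropLeaves (p ∸ i) 𝒯 else iter (grow k) (i ∸ p) 𝒯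

  𝒦 : ℕ → Tree
  𝒦 1 = node (node [] ∷ rootKids (base 1))
  𝒦 i = base i

  numKids : Maybe Tree → ℕ
  numKids = maybe (λ t → length (rootKids t)) 0

  -- children of a node in 𝒦 (the i-th supernode has the (i-1)-st
  -- supernode as an additional child, for i ≥ 2)
  kidsK : Addr → List Addr
  kidsK (sup zero) = []
  kidsK (sup (suc zero)) =
    map (λ c → reg 1 (c ∷ [])) (upTo (length (rootKids (𝒦 1))))
  kidsK (sup (suc (suc i))) =
    sup (suc i) ∷ map (λ c → reg (suc (suc i)) (c ∷ [])) (upTo (length (rootKids (𝒦 (suc (suc i))))))
  kidsK (reg i path) =
    map (λ c → reg i (path ++ (c ∷ []))) (upTo (numKids (subAt (𝒦 i) path)))

  isLeafK : Addr → Bool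
  isLeafK x = null (kidsK x)

  isPenultK : Addr → Bool
  isPenultK x = not (null (kidsK x)) ∧ all isLeafK (kidsK x)

  nLabels : Addr → ℕ
  nLabels (sup _) = s
  nLabels (reg _ _) = j

  traversal : ℕ → List Addr
  traversal zero = []
  traversal (suc zero) =
    map (reg 1) (pathsT (0 ∷ []) (node [])) ++
    sup 1 ∷ map (reg 1) (pathsL [] 1 (rootKids (base 1)))
  traversal i@(suc (suc _)) = sup i ∷ map (reg i) (pathsL [] 0 (rootKids (𝒦 i)))

  seqK : ℕ → List Addr
  seqK zero = []
  seqK (suc i) = seqK i ++ traversal (suc i)

  -- the labels 1,2,… of 𝒦_1 … 𝒦_i, each listed as the node carrying it
  labelsList : ℕ → List Addr
  labelsList i = concatMap (λ x → replicate (nLabels x) x) (seqK i)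

  -- N(i): the largest label in 𝒦_i
  N : ℕ → ℕ
  N i = sum (map nLabels (seqK i))

  -- the node carrying label ℓ (ℓ ≥ 1); 𝒦_1..𝒦_(ℓ+1) carry more than ℓ labels
  labelNode : ℕ → Maybe Addr
  labelNode ℓ = nth (labelsList (suc ℓ)) (ℓ ∸ 1)

  isLeafLabel : ℕ → Bool
  isLeafLabel ℓ = maybe isLeafK false (labelNode ℓ)

  isPenultLabel : ℕ → Bool
  isPenultLabel ℓ = maybe isPenultK false (labelNode ℓ)

  LeafLabel : ℕ → Set
  LeafLabel ℓ = T (isLeafLabel ℓ)

  PenultLabel : ℕ → Set
  PenultLabel ℓ = T (isPenultLabel ℓ)

  R : ℕ → ℕ
  R zero = 0
  R (suc n) = (if isLeafLabel (suc n) then 1 else 0) + R n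

  α : ℕ
  α = sum (map (λ x → if isLeafK x then nLabels x else 0) (seqK p))

  β : ℕ
  β = sum (map (λ x → if isPenultK x then nLabels x else 0) (seqK p))

  ν : ℤ
  ν = + α - (+ k *ℤ ((+ β - + s) +ℤ + j))

  -- 𝒦(m): the nodes (in traversal order) up to and including the node
  -- carrying label m, each paired with the number of its labels among 1..m.
  -- (A node is included iff fewer than m labels precede it.)
  prefixFrom : ℕ → List Addr → List (Addr × ℕ)
  prefixFrom _ [] = []
  prefixFrom zero (_ ∷ _) = []
  prefixFrom m@(suc _) (x ∷ xs) = (x , nLabels x ⊓ m) ∷ prefixFrom (m ∸ nLabels x) xs

  𝒦[_] : ℕ → List (Addr × ℕ)
  𝒦[ m ] = prefixFrom m (seqK (suc m))

  Complete : ℕ → Set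
  Complete m =
    All (λ xc → T (isPenultK (proj₁ xc)) →
                All (λ c → (c , nLabels c) ∈ 𝒦[ m ]) (kidsK (proj₁ xc)))
        𝒦[ m ]

  IsΔ : ℕ → ℕ → Set
  IsΔ n d = Complete (n + d) × (∀ d' → d' < d → ¬ Complete (n + d'))

  -- 𝒫𝒦(n): delete the nodes that are leaves of 𝒦, the first supernode
  -- becomes a regular node with j labels (relabeling does not change counts)
  𝒫𝒦[_] : ℕ → List (Addr × ℕ)
  𝒫𝒦[ n ] = map fix (filter (λ xc → not (isLeafK (proj₁ xc)) Data.Bool.≟ true) 𝒦[ n ])
    where
      fix : Addr × ℕ → Addr × ℕ
      fix (sup (suc zero) , _) = (sup 1 , j)
      fix xc = xc

  -- 𝒫R(n): number of leaf labels of 𝒫𝒦(n) (labels in penultimate nodes of 𝒦)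
  𝒫R : ℕ → ℕ
  𝒫R n = sum (map (λ xc → if isPenultK (proj₁ xc) then proj₂ xc else 0) 𝒫𝒦[ n ])

-- Beyond level p every 𝒦_i arises from a nonempty tree by attaching k new children to each
-- leaf, so after 𝒦_1, …, 𝒦_p the traversal is a sequence of blocks: an interior node (neither
-- a leaf nor penultimate), or a penultimate node immediately followed by its k leaf children
-- of j labels each. In every block the leaf labels number exactly k times the labels that
-- become leaf labels after pruning; together with the contributions α and β of 𝒦_1, …, 𝒦_p
-- this gives the formulas for 𝒫R(n). If label n lies in an interior node, 𝒦(n) is complete.
-- If it is the o-th of the w = j + kj labels of a family, 𝒦(m) first becomes complete when
-- the family is finished, so Δ(n) = w − o, and n is a penultimate label iff o ≤ j iff Δ(n) ≥ kj.

module Submission where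

open import Defs
open import Data.Nat using (ℕ; zero; suc; pred; _+_; _*_; _∸_; _≤_; _<_; _>_; _⊔_; _⊓_; z≤n; s≤s)
open import Data.Nat.Properties hiding (_≟_)
open import Data.List using (List; []; _∷_; _++_; map; length; replicate; concatMap; filter; upTo; applyUpTo; initLast; _∷ʳ′_)
open import Data.Bool using (Bool; true; false; not; if_then_else_; T)
open import Data.Bool.Properties using (_≟_; T-≡)
open import Function.Bundles using (Equivalence)
open import Data.Bool.ListAction using (all)
open import Data.Nat.ListAction using (sum)
open import Data.Nat.ListAction.Properties using (sum-++)
open import Data.List.Properties using (++-assoc; ++-identityʳ; ++-identityʳ-unique; ++-cancelˡ; ∷-injectiveˡ; map-++; length-++; length-replicate; length-applyUpTo; map-applyUpTo; map-upTo; map-∘)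
open import Data.List.Relation.Unary.All as All using (All; []; _∷_)
import Data.List.Relation.Unary.All.Properties as All
open import Data.List.Relation.Unary.Any using (here; there)
open import Data.List.Relation.Unary.Unique.Propositional using (Unique; []; _∷_)
import Data.List.Relation.Unary.Unique.Propositional.Properties as Unique
open import Data.List.Membership.Propositional using (_∈_)
open import Data.List.Membership.Propositional.Properties using (∈-++⁺ˡ; ∈-++⁺ʳ; ∈-++⁻; ∈-map⁺; ∈-map⁻)
open import Data.Maybe using (Maybe; just; maybe)
open import Data.Product using (_×_; _,_; proj₁; proj₂; ∃)
open import Data.Sum using (_⊎_; inj₁; inj₂)
open import Data.Empty using (⊥; ⊥-elim)
open import Data.Unit using (tt)
open import Function using (case_of_)
open import Relation.Nullary using (¬_; yes; no)
open import Relation.Binary.Definitions using (tri<; tri≈; tri>)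
open import Relation.Binary.PropositionalEquality

if-true : ∀ {A : Set} {b} {x y : A} → T b → (if b then x else y) ≡ x
if-true {b = true} _ = refl

if-false : ∀ {A : Set} {b} {x y : A} → ¬ T b → (if b then x else y) ≡ y
if-false {b = false} _ = refl
if-false {b = true} ¬t = ⊥-elim (¬t tt)

∸-telescope : ∀ {a b c} → a ≤ b → b ≤ c → (b ∸ a) + (c ∸ b) ≡ c ∸ a
∸-telescope {a} {b} {c} a≤b b≤c = +-cancelˡ-≡ a _ _ (begin
  a + ((b ∸ a) + (c ∸ b))   ≡⟨ sym (+-assoc a (b ∸ a) (c ∸ b)) ⟩
  a + (b ∸ a) + (c ∸ b)     ≡⟨ cong (_+ (c ∸ b)) (m+[n∸m]≡n a≤b) ⟩
  b + (c ∸ b)               ≡⟨ m+[n∸m]≡n b≤c ⟩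
  c                         ≡⟨ sym (m+[n∸m]≡n (≤-trans a≤b b≤c)) ⟩
  a + (c ∸ a)               ∎)
  where open ≡-Reasoning

module _ {A : Set} where
  ∷ʳ-view : ∀ (xs : List A) → 0 < length xs → ∃ λ ys → ∃ λ y → xs ≡ ys ++ y ∷ []
  ∷ʳ-view xs 0<n with initLast xs
  ... | [] = case 0<n of λ ()
  ... | ys ∷ʳ′ y = ys , y , refl

  nth-++ˡ : ∀ (xs ys : List A) {i} → i < length xs → nth (xs ++ ys) i ≡ nth xs i
  nth-++ˡ (x ∷ xs) ys {zero} _ = refl
  nth-++ˡ (x ∷ xs) ys {suc i} (s≤s i<n) = nth-++ˡ xs ys i<n

  nth-++ʳ : ∀ (xs ys : List A) i → nth (xs ++ ys) (length xs + i) ≡ nth ys i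
  nth-++ʳ [] ys i = refl
  nth-++ʳ (x ∷ xs) ys i = nth-++ʳ xs ys i

  nth-replicate-++ : ∀ v (x : A) ys {i} → i < v → nth (replicate v x ++ ys) i ≡ just x
  nth-replicate-++ (suc v) x ys {zero} _ = refl
  nth-replicate-++ (suc v) x ys {suc i} (s≤s i<v) = nth-replicate-++ v x ys i<v

  nth-replicate-++ʳ : ∀ v (x : A) ys t → nth (replicate v x ++ ys) (v + t) ≡ nth ys t
  nth-replicate-++ʳ zero x ys t = refl
  nth-replicate-++ʳ (suc v) x ys t = nth-replicate-++ʳ v x ys t

  sum-filter : ∀ (b : A → Bool) (f : A → ℕ) xs →
               sum (map f (filter (λ a → b a ≟ true) xs)) ≡ sum (map (λ a → if b a then f a else 0) xs)
  sum-filter b f [] = refl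
  sum-filter b f (x ∷ xs) with b x
  ... | true = cong (f x +_) (sum-filter b f xs)
  ... | false = sum-filter b f xs

  sum-map-++ : ∀ (f : A → ℕ) xs ys → sum (map f (xs ++ ys)) ≡ sum (map f xs) + sum (map f ys)
  sum-map-++ f xs ys = trans (cong sum (map-++ f xs ys)) (sum-++ (map f xs) (map f ys))

  unique-++-disjoint : ∀ (xs : List A) {ys x} → Unique (xs ++ ys) → x ∈ xs → x ∈ ys → ⊥
  unique-++-disjoint (_ ∷ xs) (x≢ ∷ _) (here refl) x∈ys = All.lookup x≢ (∈-++⁺ʳ xs x∈ys) refl
  unique-++-disjoint (_ ∷ xs) (_ ∷ u) (there x∈xs) x∈ys = unique-++-disjoint xs u x∈xs x∈ys

-- ℤ is opened only locally: its prefix +_ would make ℕ sections such as (m +_) ambiguous.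
module _ where
  open import Data.Integer using (+_; _-_) renaming (_+_ to _+ℤ_)
  open import Data.Integer.Tactic.RingSolver using (solve-∀)

  -- + (m + n) reduces to + m +ℤ + n, so equations between ℕ sums transfer to ℤ by conversion.
  pos-rearrange : ∀ x y a b c → x + a + c ≡ y + b → + x ≡ (+ y - (+ a - + b)) - + c
  pos-rearrange x y a b c eq = begin
    + x                              ≡⟨ cancel (+ x) (+ a) (+ c) ⟩
    + (x + a + c) - + a - + c        ≡⟨ cong (λ z → + z - + a - + c) eq ⟩
    + (y + b) - + a - + c            ≡⟨ regroup (+ y) (+ a) (+ b) (+ c) ⟩
    (+ y - (+ a - + b)) - + c        ∎
    where
      open ≡-Reasoning
      cancel : ∀ x a c → x ≡ x +ℤ a +ℤ c - a - c
      cancel = solve-∀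
      regroup : ∀ y a b c → y +ℤ b - a - c ≡ (y - (a - b)) - c
      regroup = solve-∀

  pos-minus-plus : ∀ x b s j → x + s ≡ b + j → (+ b - + s) +ℤ + j ≡ + x
  pos-minus-plus x b s j eq = begin
    (+ b - + s) +ℤ + j    ≡⟨ regroup (+ b) (+ s) (+ j) ⟩
    + (b + j) - + s       ≡⟨ cong (λ z → + z - + s) (sym eq) ⟩
    + (x + s) - + s       ≡⟨ cancel (+ x) (+ s) ⟩
    + x                   ∎
    where
      open ≡-Reasoning
      regroup : ∀ b s j → (b - s) +ℤ j ≡ (b +ℤ j) - s
      regroup = solve-∀
      cancel : ∀ x s → (x +ℤ s) - s ≡ x
      cancel = solve-∀

  pos-+-minus : ∀ m e → + (m + e) - + m ≡ + e
  pos-+-minus m e = cancel (+ m) (+ e)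
    where
      cancel : ∀ m e → (m +ℤ e) - m ≡ e
      cancel = solve-∀

mutual
  subAt-++ : ∀ t p r {u} → subAt t p ≡ just u → subAt t (p ++ r) ≡ subAt u r
  subAt-++ t [] r refl = refl
  subAt-++ (node ts) (c ∷ p) r e = subAtL-++ ts c p r e

  subAtL-++ : ∀ ts c p r {u} → subAtL ts c p ≡ just u → subAtL ts c (p ++ r) ≡ subAt u r
  subAtL-++ (t ∷ ts) zero p r e = subAt-++ t p r e
  subAtL-++ (t ∷ ts) (suc c) p r e = subAtL-++ ts c p r e

subAt-child : ∀ t c → subAt t (c ∷ []) ≡ subAtL (rootKids t) c []
subAt-child (node ts) c = refl

mutual
  pathsT-extends : ∀ p t {q} → q ∈ pathsT p t → ∃ λ r → q ≡ p ++ r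
  pathsT-extends p (node ts) (here refl) = [] , sym (++-identityʳ p)
  pathsT-extends p (node ts) (there q∈) with pathsL-extends p 0 ts q∈
  ... | c , r , _ , q≡ = c ∷ r , q≡

  pathsL-extends : ∀ p c ts {q} → q ∈ pathsL p c ts → ∃ λ c' → ∃ λ r → c ≤ c' × q ≡ p ++ c' ∷ r
  pathsL-extends p c (t ∷ ts) q∈ with ∈-++⁻ (pathsT (p ++ c ∷ []) t) q∈
  ... | inj₁ q∈t with pathsT-extends (p ++ c ∷ []) t q∈t
  ...   | r , q≡ = c , r , ≤-refl , trans q≡ (++-assoc p (c ∷ []) r)
  pathsL-extends p c (t ∷ ts) q∈ | inj₂ q∈ts with pathsL-extends p (suc c) ts q∈ts
  ...   | c' , r , c<c' , q≡ = c' , r , <⇒≤ c<c' , q≡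

mutual
  pathsT-unique : ∀ p t → Unique (pathsT p t)
  pathsT-unique p (node ts) = All.tabulate p∉ ∷ pathsL-unique p 0 ts
    where
      p∉ : ∀ {q} → q ∈ pathsL p 0 ts → p ≢ q
      p∉ q∈ p≡q with pathsL-extends p 0 ts q∈
      ... | _ , _ , _ , q≡ = case ++-identityʳ-unique p (trans p≡q q≡) of λ ()

  pathsL-unique : ∀ p c ts → Unique (pathsL p c ts)
  pathsL-unique p c [] = []
  pathsL-unique p c (t ∷ ts) =
    Unique.++⁺ (pathsT-unique (p ++ c ∷ []) t) (pathsL-unique p (suc c) ts) disjoint
    where
      disjoint : ∀ {q} → ¬ (q ∈ pathsT (p ++ c ∷ []) t × q ∈ pathsL p (suc c) ts)
      disjoint (q∈t , q∈ts) with pathsT-extends (p ++ c ∷ []) t q∈t | pathsL-extends p (suc c) ts q∈ts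
      ... | r , q≡ | c' , r' , c<c' , q≡' =
        <-irrefl (∷-injectiveˡ (++-cancelˡ p _ _ (trans (sym (trans q≡ (++-assoc p (c ∷ []) r))) q≡'))) c<c'

child∈pathsL : ∀ p c₀ ts {c} → c < length ts → p ++ (c₀ + c) ∷ [] ∈ pathsL p c₀ ts
child∈pathsL p c₀ (node _ ∷ ts) {zero} _ rewrite +-identityʳ c₀ = here refl
child∈pathsL p c₀ (t ∷ ts) {suc c} (s≤s c<n) rewrite +-suc c₀ c =
  ∈-++⁺ʳ (pathsT (p ++ c₀ ∷ []) t) (child∈pathsL p (suc c₀) ts c<n)

leaf-paths : ∀ q c n {f : ℕ → List ℕ} → (∀ c' → q ++ (c + c') ∷ [] ≡ f c') →
             pathsL q c (replicate n (node [])) ≡ applyUpTo f n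
leaf-paths q c zero _ = refl
leaf-paths q c (suc n) f≡ =
  cong₂ _∷_ (trans (cong (λ c' → q ++ c' ∷ []) (sym (+-identityʳ c))) (f≡ 0))
            (leaf-paths q (suc c) n (λ c' → trans (cong (λ c'' → q ++ c'' ∷ []) (sym (+-suc c c'))) (f≡ (suc c'))))

childCount : Maybe Tree → ℕ
childCount = maybe (λ t → length (rootKids t)) 0

module _ (G : Tree) where
  mutual
    pathsT-child-closed : ∀ p t → subAt G p ≡ just t → ∀ {q c} → q ∈ pathsT p t →
                          c < childCount (subAt G q) → q ++ c ∷ [] ∈ pathsT p t
    pathsT-child-closed p (node ts) t-at-p (here refl) c<n =
      there (child∈pathsL p 0 ts (subst (λ u → _ < childCount u) t-at-p c<n))
    pathsT-child-closed p (node ts) t-at-p (there q∈) c<n =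
      there (pathsL-child-closed p 0 ts (λ c → subAt-++ G p (c ∷ []) t-at-p) q∈ c<n)

    pathsL-child-closed : ∀ p c₀ ts → (∀ c → subAt G (p ++ (c₀ + c) ∷ []) ≡ subAtL ts c []) →
                          ∀ {q c} → q ∈ pathsL p c₀ ts →
                          c < childCount (subAt G q) → q ++ c ∷ [] ∈ pathsL p c₀ ts
    pathsL-child-closed p c₀ (t ∷ ts) ts-at-p q∈ c<n with ∈-++⁻ (pathsT (p ++ c₀ ∷ []) t) q∈
    ... | inj₁ q∈t = ∈-++⁺ˡ (pathsT-child-closed (p ++ c₀ ∷ []) t t-at-p q∈t c<n)
      where
        t-at-p : subAt G (p ++ c₀ ∷ []) ≡ just t
        t-at-p = subst (λ c → subAt G (p ++ c ∷ []) ≡ just t) (+-identityʳ c₀) (ts-at-p 0)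
    ... | inj₂ q∈ts = ∈-++⁺ʳ (pathsT (p ++ c₀ ∷ []) t) (pathsL-child-closed p (suc c₀) ts ts-at-p' q∈ts c<n)
      where
        ts-at-p' : ∀ c → subAt G (p ++ (suc c₀ + c) ∷ []) ≡ subAtL ts c []
        ts-at-p' c = subst (λ c' → subAt G (p ++ c' ∷ []) ≡ subAtL ts c []) (+-suc c₀ c) (ts-at-p (suc c))

height-dropLeaves : ∀ t → height (dropLeaves t) ≡ pred (height t)
height-dropLeaves (node []) = refl
height-dropLeaves (node ts@(_ ∷ _)) = dropL ts
  where
    suc-⊔-height : ∀ a l → suc (a ⊔ heightL l) ≡ suc a ⊔ height (node l)
    suc-⊔-height a [] = cong suc (⊔-identityʳ a)
    suc-⊔-height a (_ ∷ _) = refl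

    dropL : ∀ ts → height (node (dropLeavesL ts)) ≡ heightL ts
    dropL [] = refl
    dropL (node [] ∷ ts) = dropL ts
    dropL (node us@(_ ∷ _) ∷ ts) =
      trans (suc-⊔-height (height (node (dropLeavesL us))) (dropLeavesL ts))
            (cong₂ (λ a b → suc a ⊔ b) (dropL us) (dropL ts))

height-iter-dropLeaves : ∀ r t → height (iter dropLeaves r t) ≡ height t ∸ r
height-iter-dropLeaves zero t = refl
height-iter-dropLeaves (suc r) t = begin
  height (dropLeaves (iter dropLeaves r t))  ≡⟨ height-dropLeaves (iter dropLeaves r t) ⟩
  pred (height (iter dropLeaves r t))        ≡⟨ cong pred (height-iter-dropLeaves r t) ⟩
  pred (height t ∸ r)                        ≡⟨ pred[m∸n]≡m∸[1+n] (height t) r ⟩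
  height t ∸ suc r                           ∎
  where open ≡-Reasoning

positive-height-nonleaf : ∀ t → 1 ≤ height t → ∃ λ u → ∃ λ us → t ≡ node (u ∷ us)
positive-height-nonleaf (node (u ∷ us)) _ = u , us , refl

height≡1⇒kids-leaves : ∀ t → height t ≡ 1 → All (_≡ node []) (rootKids t)
height≡1⇒kids-leaves (node []) _ = []
height≡1⇒kids-leaves (node ts@(_ ∷ _)) h≡1 = heightL≡0 ts (suc-injective h≡1)
  where
    height≡0 : ∀ t → height t ≡ 0 → t ≡ node []
    height≡0 (node []) _ = refl

    heightL≡0 : ∀ ts → heightL ts ≡ 0 → All (_≡ node []) ts
    heightL≡0 [] _ = []
    heightL≡0 (u ∷ us) h≡0 =
      height≡0 u (n≤0⇒n≡0 (subst (height u ≤_) h≡0 (m≤m⊔n (height u) (heightL us))))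
      ∷ heightL≡0 us (n≤0⇒n≡0 (subst (heightL us ≤_) h≡0 (m≤n⊔m (height u) (heightL us))))

grow-nonleaf : ∀ k' u → ∃ λ v → ∃ λ vs → grow (suc k') u ≡ node (v ∷ vs)
grow-nonleaf k' (node []) = node [] , replicate k' (node []) , refl
grow-nonleaf k' (node (t ∷ ts)) = grow (suc k') t , growL (suc k') ts , refl

reg-injective : ∀ {i a b} → reg i a ≡ reg i b → a ≡ b
reg-injective refl = refl

index : Addr → ℕ
index (sup i) = i
index (reg i _) = i

module Analysis (k' j' s : ℕ) (𝒯 : Tree) (2≤p : 2 ≤ height 𝒯) where

  k j : ℕ
  k = suc k'
  j = suc j'

  open Construction k j s 𝒯

  leaf⇒¬penult : ∀ x → isLeafK x ≡ true → isPenultK x ≡ false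
  leaf⇒¬penult x with kidsK x
  ... | [] = λ _ → refl
  ... | _ ∷ _ = λ ()

  penult⇒¬leaf : ∀ x → isPenultK x ≡ true → isLeafK x ≡ false
  penult⇒¬leaf x with kidsK x
  ... | [] = λ ()
  ... | _ ∷ _ = λ _ → refl

  penult-intro : ∀ x {c cs} → kidsK x ≡ c ∷ cs → All (λ y → isLeafK y ≡ true) (c ∷ cs) → isPenultK x ≡ true
  penult-intro x {c} {cs} kids≡ leaves rewrite kids≡ = all-true (c ∷ cs) leaves
    where
      all-true : ∀ ys → All (λ y → isLeafK y ≡ true) ys → all isLeafK ys ≡ true
      all-true [] [] = refl
      all-true (y ∷ ys) (leaf ∷ leaves) rewrite leaf = all-true ys leaves

  leaf-reg : ∀ i q → subAt (𝒦 i) q ≡ just (node []) → isLeafK (reg i q) ≡ true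
  leaf-reg i q at≡ rewrite at≡ = refl

  nonleaf-reg : ∀ i q {v vs} → subAt (𝒦 i) q ≡ just (node (v ∷ vs)) → isLeafK (reg i q) ≡ false
  nonleaf-reg i q at≡ rewrite at≡ = refl

  1≤p : 1 ≤ p
  1≤p = ≤-trans (s≤s z≤n) 2≤p

  base-≤p : ∀ {i} → i ≤ p → base i ≡ iter dropLeaves (p ∸ i) 𝒯
  base-≤p {i} i≤p = if-true (≤⇒≤ᵇ i≤p)

  base->p : ∀ {i} → p < i → base i ≡ iter (grow k) (i ∸ p) 𝒯
  base->p {i} p<i = if-false (λ t → <⇒≱ p<i (≤ᵇ⇒≤ i p t))

  𝒦≡base : ∀ {i} → 2 ≤ i → 𝒦 i ≡ base i
  𝒦≡base {suc (suc i)} _ = refl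
  𝒦≡base {suc zero} (s≤s ())

  height-base : ∀ {i} → i ≤ p → height (base i) ≡ i
  height-base {i} i≤p = trans (cong height (base-≤p i≤p)) (trans (height-iter-dropLeaves (p ∸ i) 𝒯) (m∸[m∸n]≡n i≤p))

  iter-grow-nonleaf : ∀ m → ∃ λ u → ∃ λ us → iter (grow k) m 𝒯 ≡ node (u ∷ us)
  iter-grow-nonleaf zero = positive-height-nonleaf 𝒯 1≤p
  iter-grow-nonleaf (suc m) = grow-nonleaf k' (iter (grow k) m 𝒯)

  𝒦-grown : ∀ {i} → p < i → ∃ λ b → ∃ λ bs → 𝒦 i ≡ grow k (node (b ∷ bs))
  𝒦-grown {i} p<i with iter-grow-nonleaf (i ∸ suc p)
  ... | b , bs , iter≡ = b , bs , (begin
    𝒦 i                              ≡⟨ 𝒦≡base (≤-trans 2≤p (<⇒≤ p<i)) ⟩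
    base i                           ≡⟨ base->p p<i ⟩
    iter (grow k) (i ∸ p) 𝒯          ≡⟨ cong (λ m → iter (grow k) m 𝒯) (+-∸-assoc 1 p<i) ⟩
    grow k (iter (grow k) (i ∸ suc p) 𝒯) ≡⟨ cong (grow k) iter≡ ⟩
    grow k (node (b ∷ bs))           ∎)
    where open ≡-Reasoning

  𝒦-nonleaf : ∀ {i} → 2 ≤ i → ∃ λ u → ∃ λ us → 𝒦 i ≡ node (u ∷ us)
  𝒦-nonleaf {i} 2≤i with i ≤? p
  ... | yes i≤p = positive-height-nonleaf (𝒦 i)
        (subst (1 ≤_) (sym (trans (cong height (𝒦≡base 2≤i)) (height-base i≤p))) (≤-trans (s≤s z≤n) 2≤i))
  ... | no i≰p with 𝒦-grown (≰⇒> i≰p)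
  ...   | b , bs , 𝒦≡ with grow-nonleaf k' (node (b ∷ bs))
  ...     | v , vs , grow≡ = v , vs , trans 𝒦≡ grow≡

  sup1-penult : isPenultK (sup 1) ≡ true
  sup1-penult = penult-intro (sup 1) refl
    (All.map⁺ (All.applyUpTo⁺₁ (λ c → c) (length (rootKids (𝒦 1)))
      (λ {c} c<n → leaf-reg 1 (c ∷ []) (kid-leaf (refl ∷ height≡1⇒kids-leaves (base 1) (height-base 1≤p)) c<n))))
    where
      kid-leaf : ∀ {ts c} → All (_≡ node []) ts → c < length ts → subAtL ts c [] ≡ just (node [])
      kid-leaf {c = zero} (refl ∷ _) _ = refl
      kid-leaf {c = suc c} (_ ∷ leaves) (s≤s c<n) = kid-leaf leaves c<n

  traversal-index : ∀ i → All (λ x → index x ≡ i) (traversal i)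
  traversal-index zero = []
  traversal-index (suc zero) = refl ∷ refl ∷ All.map⁺ (All.tabulate (λ _ → refl))
  traversal-index (suc (suc i)) = refl ∷ All.map⁺ (All.tabulate (λ _ → refl))

  seqK-index : ∀ i → All (λ x → index x ≤ i) (seqK i)
  seqK-index zero = []
  seqK-index (suc i) = All.++⁺ (All.map m≤n⇒m≤1+n (seqK-index i)) (All.map ≤-reflexive (traversal-index (suc i)))

  sup∉map-reg : ∀ {i i' qs} → All (sup i ≢_) (map (reg i') qs)
  sup∉map-reg = All.map⁺ (All.tabulate (λ _ ()))

  traversal-unique : ∀ i → Unique (traversal i)
  traversal-unique zero = []
  traversal-unique (suc zero) =
    ((λ ()) ∷ All.tabulate first∉) ∷ sup∉map-reg ∷ Unique.map⁺ reg-injective (pathsL-unique [] 1 (rootKids (base 1)))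
    where
      first∉ : ∀ {y} → y ∈ map (reg 1) (pathsL [] 1 (rootKids (base 1))) → reg 1 (0 ∷ []) ≢ y
      first∉ y∈ refl with ∈-map⁻ (reg 1) y∈
      ... | q , q∈ , q≡ with pathsL-extends [] 1 (rootKids (base 1)) q∈
      ...   | c , _ , 1≤c , q≡' with trans (reg-injective q≡) q≡'
      ...     | refl = case 1≤c of λ ()
  traversal-unique (suc (suc i)) =
    sup∉map-reg ∷ Unique.map⁺ reg-injective (pathsL-unique [] 0 (rootKids (𝒦 (suc (suc i)))))

  seqK-unique : ∀ i → Unique (seqK i)
  seqK-unique zero = []
  seqK-unique (suc i) = Unique.++⁺ (seqK-unique i) (traversal-unique (suc i)) disjoint
    where
      disjoint : ∀ {x} → ¬ (x ∈ seqK i × x ∈ traversal (suc i))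
      disjoint (x∈s , x∈t) = 1+n≰n (subst (_≤ i) (All.lookup (traversal-index (suc i)) x∈t) (All.lookup (seqK-index i) x∈s))

  module _ (i : ℕ) where
    private
      regs : List Addr
      regs = map (reg i) (pathsL [] 0 (rootKids (𝒦 i)))

    reg-children-closed : ∀ {q} → q ∈ pathsL [] 0 (rootKids (𝒦 i)) → All (_∈ regs) (kidsK (reg i q))
    reg-children-closed {q} q∈ = All.map⁺ (All.applyUpTo⁺₁ (λ c → c) (numKids (subAt (𝒦 i) q))
      (λ c<n → ∈-map⁺ (reg i) (pathsL-child-closed (𝒦 i) [] 0 (rootKids (𝒦 i)) (subAt-child (𝒦 i)) q∈ c<n)))

    root-children∈regs : All (_∈ regs) (map (λ c → reg i (c ∷ [])) (upTo (length (rootKids (𝒦 i)))))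
    root-children∈regs = All.map⁺ (All.applyUpTo⁺₁ (λ c → c) _ (λ c<n → ∈-map⁺ (reg i) (child∈pathsL [] 0 (rootKids (𝒦 i)) c<n)))

  regs1⊆seqK1 : ∀ {y} → y ∈ map (reg 1) (pathsL [] 0 (rootKids (𝒦 1))) → y ∈ seqK 1
  regs1⊆seqK1 (here y≡) = here y≡
  regs1⊆seqK1 (there y∈) = there (there y∈)

  traversal-children : ∀ i {x} → x ∈ traversal (suc i) → All (_∈ seqK (suc i)) (kidsK x)
  traversal-children zero (here refl) = []
  traversal-children zero (there (here refl)) = All.map regs1⊆seqK1 (root-children∈regs 1)
  traversal-children zero (there (there x∈)) with ∈-map⁻ (reg 1) x∈
  ... | q , q∈ , refl = All.map regs1⊆seqK1 (reg-children-closed 1 (there q∈))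
  traversal-children (suc i) (here refl) =
    ∈-++⁺ˡ (∈-++⁺ʳ (seqK i) (sup∈traversal i)) ∷ All.map (λ y∈ → ∈-++⁺ʳ (seqK (suc i)) (there y∈)) (root-children∈regs (suc (suc i)))
    where
      sup∈traversal : ∀ i → sup (suc i) ∈ traversal (suc i)
      sup∈traversal zero = there (here refl)
      sup∈traversal (suc i) = here refl
  traversal-children (suc i) (there x∈) with ∈-map⁻ (reg (suc (suc i))) x∈
  ... | q , q∈ , refl = All.map (λ y∈ → ∈-++⁺ʳ (seqK (suc i)) (there y∈)) (reg-children-closed (suc (suc i)) q∈)

  seqK-children-closed : ∀ i → All (λ x → All (_∈ seqK i) (kidsK x)) (seqK i)
  seqK-children-closed zero = []
  seqK-children-closed (suc i) =
    All.++⁺ (All.map (All.map ∈-++⁺ˡ) (seqK-children-closed i)) (All.tabulate (traversal-children i))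

  labelCount : List Addr → ℕ
  labelCount xs = sum (map nLabels xs)

  labelCount-++ : ∀ xs ys → labelCount (xs ++ ys) ≡ labelCount xs + labelCount ys
  labelCount-++ xs ys = trans (cong sum (map-++ nLabels xs ys)) (sum-++ (map nLabels xs) (map nLabels ys))

  i≤labelCount-seqK : ∀ i → i ≤ labelCount (seqK i)
  i≤labelCount-seqK zero = z≤n
  i≤labelCount-seqK (suc i) = subst (suc i ≤_) (sym (labelCount-++ (seqK i) (traversal (suc i))))
    (subst (_≤ labelCount (seqK i) + labelCount (traversal (suc i))) (+-comm i 1) (+-mono-≤ (i≤labelCount-seqK i) (traversal-labelled i)))
    where
      traversal-labelled : ∀ i → 1 ≤ labelCount (traversal (suc i))
      traversal-labelled zero = s≤s z≤n
      traversal-labelled (suc i) with 𝒦 (suc (suc i)) | 𝒦-nonleaf {suc (suc i)} (s≤s (s≤s z≤n))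
      ... | _ | node _ , _ , refl = ≤-trans (s≤s z≤n) (m≤n+m _ s)

  seqK-prefix : ∀ {a b} → a ≤ b → ∃ λ Z → seqK b ≡ seqK a ++ Z
  seqK-prefix {a} {b} a≤b = subst (λ b → ∃ λ Z → seqK b ≡ seqK a ++ Z) (m+[n∸m]≡n a≤b) (extend (b ∸ a))
    where
      extend : ∀ d → ∃ λ Z → seqK (a + d) ≡ seqK a ++ Z
      extend zero = [] , trans (cong seqK (+-identityʳ a)) (sym (++-identityʳ (seqK a)))
      extend (suc d) with extend d
      ... | Z , seqK≡ = Z ++ traversal (suc (a + d)) ,
            trans (cong seqK (+-suc a d)) (trans (cong (_++ traversal (suc (a + d))) seqK≡) (++-assoc (seqK a) Z _))

  whole : List Addr → List (Addr × ℕ)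
  whole = map (λ x → x , nLabels x)

  prefixFrom-zero : ∀ xs → prefixFrom 0 xs ≡ []
  prefixFrom-zero [] = refl
  prefixFrom-zero (_ ∷ _) = refl

  prefixFrom-covers : ∀ {m} x xs → 1 ≤ m → nLabels x ≤ m →
                      prefixFrom m (x ∷ xs) ≡ (x , nLabels x) ∷ prefixFrom (m ∸ nLabels x) xs
  prefixFrom-covers {suc m} x xs _ n≤m = cong (λ c → (x , c) ∷ prefixFrom (suc m ∸ nLabels x) xs) (m≤n⇒m⊓n≡m n≤m)

  prefixFrom-inside : ∀ {m} x xs → 1 ≤ m → m ≤ nLabels x → prefixFrom m (x ∷ xs) ≡ (x , m) ∷ []
  prefixFrom-inside {suc m} x xs _ m≤n =
    cong₂ (λ c rest → (x , c) ∷ rest) (m≥n⇒m⊓n≡n m≤n) (trans (cong (λ m → prefixFrom m xs) (m≤n⇒m∸n≡0 m≤n)) (prefixFrom-zero xs))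

  prefixFrom-++ʳ : ∀ xs ys {o} → 1 ≤ o → prefixFrom (labelCount xs + o) (xs ++ ys) ≡ whole xs ++ prefixFrom o ys
  prefixFrom-++ʳ [] ys _ = refl
  prefixFrom-++ʳ (x ∷ xs) ys {o} 1≤o = begin
    prefixFrom (nLabels x + labelCount xs + o) (x ∷ xs ++ ys)
      ≡⟨ prefixFrom-covers x (xs ++ ys) (≤-trans 1≤o (m≤n+m o _)) (≤-trans (m≤m+n _ _) (m≤m+n _ o)) ⟩
    (x , nLabels x) ∷ prefixFrom (nLabels x + labelCount xs + o ∸ nLabels x) (xs ++ ys)
      ≡⟨ cong (λ m → (x , nLabels x) ∷ prefixFrom m (xs ++ ys)) (trans (cong (_∸ nLabels x) (+-assoc (nLabels x) _ o)) (m+n∸m≡n (nLabels x) _)) ⟩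
    (x , nLabels x) ∷ prefixFrom (labelCount xs + o) (xs ++ ys)
      ≡⟨ cong ((x , nLabels x) ∷_) (prefixFrom-++ʳ xs ys 1≤o) ⟩
    (x , nLabels x) ∷ whole xs ++ prefixFrom o ys ∎
    where open ≡-Reasoning

  prefixFrom-labelCount : ∀ xs ys → All (λ x → 1 ≤ nLabels x) xs → prefixFrom (labelCount xs) (xs ++ ys) ≡ whole xs
  prefixFrom-labelCount [] ys [] = prefixFrom-zero ys
  prefixFrom-labelCount (x ∷ xs) ys (1≤n ∷ pos) =
    trans (prefixFrom-covers x (xs ++ ys) (≤-trans 1≤n (m≤m+n _ _)) (m≤m+n _ _))
          (cong ((x , nLabels x) ∷_) (trans (cong (λ m → prefixFrom m (xs ++ ys)) (m+n∸m≡n (nLabels x) _))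
                                            (prefixFrom-labelCount xs ys pos)))

  prefixFrom-++ˡ : ∀ xs ys {m} → m ≤ labelCount xs → prefixFrom m (xs ++ ys) ≡ prefixFrom m xs
  prefixFrom-++ˡ [] ys {zero} _ = prefixFrom-zero ys
  prefixFrom-++ˡ (x ∷ xs) ys {zero} _ = refl
  prefixFrom-++ˡ (x ∷ xs) ys {suc m} m≤ =
    cong ((x , nLabels x ⊓ suc m) ∷_) (prefixFrom-++ˡ xs ys (m≤n+o⇒m∸n≤o (suc m) (nLabels x) m≤))

  ∈-prefixFrom : ∀ {m z c} xs → (z , c) ∈ prefixFrom m xs → z ∈ xs
  ∈-prefixFrom {suc m} (x ∷ xs) (here refl) = here refl
  ∈-prefixFrom {suc m} (x ∷ xs) (there zc∈) = there (∈-prefixFrom xs zc∈)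

  ∈-prefixFrom-cut : ∀ xs y ys {m z c} → m < labelCount xs + nLabels y → (z , c) ∈ prefixFrom m (xs ++ y ∷ ys) →
                     z ∈ xs ⊎ (z ≡ y × c < nLabels y)
  ∈-prefixFrom-cut xs y ys {m} {z} {c} m< zc∈ with m ≤? labelCount xs
  ... | yes m≤ = inj₁ (∈-prefixFrom xs (subst (_ ∈_) (prefixFrom-++ˡ xs (y ∷ ys) m≤) zc∈))
  ... | no m≰ = from-split (∈-++⁻ (whole xs) (subst (_ ∈_) split zc∈))
    where
      o = m ∸ labelCount xs
      m≡ : labelCount xs + o ≡ m
      m≡ = m+[n∸m]≡n (<⇒≤ (≰⇒> m≰))
      1≤o : 1 ≤ o
      1≤o = m<n⇒0<n∸m (≰⇒> m≰)
      o<n : o < nLabels y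
      o<n = +-cancelˡ-< (labelCount xs) o (nLabels y) (subst (_< labelCount xs + nLabels y) (sym m≡) m<)
      split : prefixFrom m (xs ++ y ∷ ys) ≡ whole xs ++ (y , o) ∷ []
      split = trans (cong (λ m → prefixFrom m (xs ++ y ∷ ys)) (sym m≡))
                    (trans (prefixFrom-++ʳ xs (y ∷ ys) 1≤o) (cong (whole xs ++_) (prefixFrom-inside y ys 1≤o (<⇒≤ o<n))))
      from-split : (z , c) ∈ whole xs ⊎ (z , c) ∈ (y , o) ∷ [] → z ∈ xs ⊎ (z ≡ y × c < nLabels y)
      from-split (inj₁ zc∈xs) with ∈-map⁻ _ zc∈xs
      ... | _ , z∈ , refl = inj₁ z∈
      from-split (inj₂ (here refl)) = inj₂ (refl , o<n)

  labelsOf : List Addr → List Addr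
  labelsOf = concatMap (λ x → replicate (nLabels x) x)

  labelsOf-++ : ∀ xs ys → labelsOf (xs ++ ys) ≡ labelsOf xs ++ labelsOf ys
  labelsOf-++ [] ys = refl
  labelsOf-++ (x ∷ xs) ys =
    trans (cong (replicate (nLabels x) x ++_) (labelsOf-++ xs ys)) (sym (++-assoc (replicate (nLabels x) x) (labelsOf xs) (labelsOf ys)))

  length-labelsOf : ∀ xs → length (labelsOf xs) ≡ labelCount xs
  length-labelsOf [] = refl
  length-labelsOf (x ∷ xs) =
    trans (length-++ (replicate (nLabels x) x)) (cong₂ _+_ (length-replicate (nLabels x)) (length-labelsOf xs))

  nth-labelsOf-++ʳ : ∀ xs ys t → nth (labelsOf (xs ++ ys)) (labelCount xs + t) ≡ nth (labelsOf ys) t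
  nth-labelsOf-++ʳ xs ys t = begin
    nth (labelsOf (xs ++ ys)) (labelCount xs + t)           ≡⟨ cong (λ L → nth L (labelCount xs + t)) (labelsOf-++ xs ys) ⟩
    nth (labelsOf xs ++ labelsOf ys) (labelCount xs + t)    ≡⟨ cong (λ i → nth (labelsOf xs ++ labelsOf ys) (i + t)) (sym (length-labelsOf xs)) ⟩
    nth (labelsOf xs ++ labelsOf ys) (length (labelsOf xs) + t) ≡⟨ nth-++ʳ (labelsOf xs) (labelsOf ys) t ⟩
    nth (labelsOf ys) t                                     ∎
    where open ≡-Reasoning

  labelNode≡nth : ∀ {ℓ M} → suc ℓ < M → labelNode (suc ℓ) ≡ nth (labelsOf (seqK M)) ℓ
  labelNode≡nth {ℓ} {M} ℓ+1<M with seqK-prefix ℓ+1<M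
  ... | Z , seqK≡ = sym (begin
    nth (labelsOf (seqK M)) ℓ                         ≡⟨ cong (λ xs → nth (labelsOf xs) ℓ) seqK≡ ⟩
    nth (labelsOf (seqK (2 + ℓ) ++ Z)) ℓ              ≡⟨ cong (λ L → nth L ℓ) (labelsOf-++ (seqK (2 + ℓ)) Z) ⟩
    nth (labelsOf (seqK (2 + ℓ)) ++ labelsOf Z) ℓ     ≡⟨ nth-++ˡ (labelsOf (seqK (2 + ℓ))) (labelsOf Z) ℓ<length ⟩
    nth (labelsOf (seqK (2 + ℓ))) ℓ                   ∎)
    where
      open ≡-Reasoning
      ℓ<length : ℓ < length (labelsOf (seqK (2 + ℓ)))
      ℓ<length = subst (ℓ <_) (sym (length-labelsOf (seqK (2 + ℓ)))) (≤-trans (n≤1+n (suc ℓ)) (i≤labelCount-seqK (2 + ℓ)))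

  𝒦[]≡prefixFrom : ∀ {m M} → m < M → 𝒦[ m ] ≡ prefixFrom m (seqK M)
  𝒦[]≡prefixFrom {m} m<M with seqK-prefix m<M
  ... | Z , seqK≡ = sym (trans (cong (prefixFrom m) seqK≡)
                               (prefixFrom-++ˡ (seqK (suc m)) Z (≤-trans (n≤1+n m) (i≤labelCount-seqK (suc m)))))

  leafPart : Addr × ℕ → ℕ
  leafPart (x , c) = if isLeafK x then c else 0

  leafLabels : List (Addr × ℕ) → ℕ
  leafLabels xs = sum (map leafPart xs)

  leafIndicator : Maybe Addr → ℕ
  leafIndicator a = if maybe isLeafK false a then 1 else 0

  leafLabels-prefixFrom-covers : ∀ x xs t → leafLabels (prefixFrom (nLabels x + t) (x ∷ xs)) ≡ leafPart (x , nLabels x) + leafLabels (prefixFrom t xs)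
  leafLabels-prefixFrom-covers x xs (suc t) = cong leafLabels (trans
    (prefixFrom-covers x xs (≤-trans (s≤s z≤n) (m≤n+m (suc t) (nLabels x))) (m≤m+n _ _))
    (cong (λ m → (x , nLabels x) ∷ prefixFrom m xs) (m+n∸m≡n (nLabels x) (suc t))))
  leafLabels-prefixFrom-covers x xs zero rewrite +-identityʳ (nLabels x) | prefixFrom-zero xs = all-labels (nLabels x) refl
    where
      all-labels : ∀ v → nLabels x ≡ v → leafLabels (prefixFrom v (x ∷ xs)) ≡ leafPart (x , v) + 0
      all-labels zero _ with isLeafK x
      ... | true = refl
      ... | false = refl
      all-labels (suc v) n≡ = cong leafLabels (prefixFrom-inside x xs (s≤s z≤n) (≤-reflexive (sym n≡)))

  leafLabels-prefixFrom-suc : ∀ xs m → leafLabels (prefixFrom (suc m) xs) ≡ leafIndicator (nth (labelsOf xs) m) + leafLabels (prefixFrom m xs)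
  leafLabels-prefixFrom-suc [] m = refl
  leafLabels-prefixFrom-suc (x ∷ xs) m with m <? nLabels x
  ... | yes m<n = trans (cong leafLabels (prefixFrom-inside x xs (s≤s z≤n) m<n))
                   (trans (inside m m<n) (cong (λ a → leafIndicator a + leafLabels (prefixFrom m (x ∷ xs))) (sym (nth-replicate-++ (nLabels x) x (labelsOf xs) m<n))))
    where
      inside : ∀ m → m < nLabels x → leafPart (x , suc m) + 0 ≡ (if isLeafK x then 1 else 0) + leafLabels (prefixFrom m (x ∷ xs))
      inside zero _ = refl
      inside (suc m) m<n =
        trans (split-first (isLeafK x)) (cong ((if isLeafK x then 1 else 0) +_) (sym (cong leafLabels (prefixFrom-inside x xs (s≤s z≤n) (<⇒≤ m<n)))))
        where
          split-first : ∀ b → (if b then suc (suc m) else 0) + 0 ≡ (if b then 1 else 0) + ((if b then suc m else 0) + 0)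
          split-first true = refl
          split-first false = refl
  ... | no m≮n rewrite sym (m+[n∸m]≡n (≮⇒≥ m≮n)) = beyond (m ∸ nLabels x)
    where
      beyond : ∀ t → leafLabels (prefixFrom (suc (nLabels x + t)) (x ∷ xs))
                     ≡ leafIndicator (nth (labelsOf (x ∷ xs)) (nLabels x + t)) + leafLabels (prefixFrom (nLabels x + t) (x ∷ xs))
      beyond t = begin
        leafLabels (prefixFrom (suc (nLabels x + t)) (x ∷ xs))   ≡⟨ cong (λ m → leafLabels (prefixFrom m (x ∷ xs))) (sym (+-suc (nLabels x) t)) ⟩
        leafLabels (prefixFrom (nLabels x + suc t) (x ∷ xs))     ≡⟨ leafLabels-prefixFrom-covers x xs (suc t) ⟩
        a + leafLabels (prefixFrom (suc t) xs)                   ≡⟨ cong (a +_) (leafLabels-prefixFrom-suc xs t) ⟩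
        a + (b + leafLabels (prefixFrom t xs))                   ≡⟨ +-comm-middle a b _ ⟩
        b + (a + leafLabels (prefixFrom t xs))                   ≡⟨ cong₂ _+_ (cong leafIndicator (sym (nth-replicate-++ʳ (nLabels x) x (labelsOf xs) t)))
                                                                              (sym (leafLabels-prefixFrom-covers x xs t)) ⟩
        leafIndicator (nth (labelsOf (x ∷ xs)) (nLabels x + t)) + leafLabels (prefixFrom (nLabels x + t) (x ∷ xs)) ∎
        where
          open ≡-Reasoning
          a = leafPart (x , nLabels x)
          b = leafIndicator (nth (labelsOf xs) t)
          +-comm-middle : ∀ a b c → a + (b + c) ≡ b + (a + c)
          +-comm-middle a b c = trans (sym (+-assoc a b c)) (trans (cong (_+ c) (+-comm a b)) (+-assoc b a c))

  R≡leafLabels : ∀ xs m → (∀ ℓ → ℓ < m → labelNode (suc ℓ) ≡ nth (labelsOf xs) ℓ) → R m ≡ leafLabels (prefixFrom m xs)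
  R≡leafLabels xs zero _ = sym (cong leafLabels (prefixFrom-zero xs))
  R≡leafLabels xs (suc m) agree = trans
    (cong₂ _+_ (cong leafIndicator (agree m ≤-refl)) (R≡leafLabels xs m (λ ℓ ℓ<m → agree ℓ (m<n⇒m<1+n ℓ<m))))
    (sym (leafLabels-prefixFrom-suc xs m))

  FullLeaf : Addr → Set
  FullLeaf c = isLeafK c ≡ true × nLabels c ≡ j

  data Blocks : List Addr → Set where
    []       : Blocks []
    interior : ∀ {x xs} → isLeafK x ≡ false → isPenultK x ≡ false → Blocks xs → Blocks (x ∷ xs)
    family   : ∀ {i q cs xs} → isPenultK (reg i q) ≡ true → kidsK (reg i q) ≡ cs → length cs ≡ k →
               All FullLeaf cs → Blocks xs → Blocks (reg i q ∷ cs ++ xs)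

  Blocks-++ : ∀ {xs ys} → Blocks xs → Blocks ys → Blocks (xs ++ ys)
  Blocks-++ [] bys = bys
  Blocks-++ (interior nl np bxs) bys = interior nl np (Blocks-++ bxs bys)
  Blocks-++ {ys = ys} (family {i} {q} {cs} {xs} pen kids≡ len leaves bxs) bys =
    subst (λ zs → Blocks (reg i q ∷ zs)) (sym (++-assoc cs xs ys)) (family pen kids≡ len leaves (Blocks-++ bxs bys))

  kids-grown-leaf : ∀ i q → subAt (𝒦 i) q ≡ just (grow k (node [])) →
                    kidsK (reg i q) ≡ map (reg i) (pathsL q 0 (replicate k (node [])))
  kids-grown-leaf i q at≡ rewrite at≡ = begin
    map (λ c → reg i (q ++ c ∷ [])) (upTo (length (replicate k (node []))))
      ≡⟨ cong (λ n → map (λ c → reg i (q ++ c ∷ [])) (upTo n)) (length-replicate k) ⟩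
    map (λ c → reg i (q ++ c ∷ [])) (upTo k)              ≡⟨ map-upTo (λ c → reg i (q ++ c ∷ [])) k ⟩
    applyUpTo (λ c → reg i (q ++ c ∷ [])) k               ≡⟨ sym (map-applyUpTo (λ c → q ++ c ∷ []) (reg i) k) ⟩
    map (reg i) (applyUpTo (λ c → q ++ c ∷ []) k)         ≡⟨ cong (map (reg i)) (sym (leaf-paths q 0 k (λ _ → refl))) ⟩
    map (reg i) (pathsL q 0 (replicate k (node [])))      ∎
    where open ≡-Reasoning

  first-kid-nonleaf⇒¬penult : ∀ i q {v vs} → subAt (𝒦 i) q ≡ just (node (v ∷ vs)) →
                              isLeafK (reg i (q ++ 0 ∷ [])) ≡ false → isPenultK (reg i q) ≡ false
  first-kid-nonleaf⇒¬penult i q at≡ nonleaf rewrite at≡ | nonleaf = refl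

  mutual
    blocks-pathsT : ∀ i q u → subAt (𝒦 i) q ≡ just (grow k u) → Blocks (map (reg i) (pathsT q (grow k u)))
    blocks-pathsT i q (node []) at≡ =
      subst (λ zs → Blocks (reg i q ∷ zs)) (++-identityʳ cs)
        (family (penult-intro (reg i q) (trans (kids-grown-leaf i q at≡) cs≡) (All.map proj₁ (subst (All FullLeaf) cs≡ kids-full)))
                (kids-grown-leaf i q at≡)
                (trans (cong length cs≡) (length-applyUpTo (λ c → reg i (q ++ c ∷ [])) k))
                kids-full [])
      where
        cs = map (reg i) (pathsL q 0 (replicate k (node [])))
        cs≡ : cs ≡ applyUpTo (λ c → reg i (q ++ c ∷ [])) k
        cs≡ = trans (cong (map (reg i)) (leaf-paths q 0 k {λ c → q ++ c ∷ []} (λ _ → refl))) (map-applyUpTo (λ c → q ++ c ∷ []) (reg i) k)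
        kids-full : All FullLeaf cs
        kids-full = subst (All FullLeaf) (sym cs≡) (All.applyUpTo⁺₁ (λ c → reg i (q ++ c ∷ [])) k (λ {c} c<k →
          leaf-reg i (q ++ c ∷ []) (trans (subAt-++ (𝒦 i) q (c ∷ []) at≡) (leaf-kid c c<k)) , refl))
          where
            leaf-kid : ∀ {n} c → c < n → subAtL (replicate n (node [])) c [] ≡ just (node [])
            leaf-kid {suc n} zero _ = refl
            leaf-kid {suc n} (suc c) (s≤s c<n) = leaf-kid c c<n
    blocks-pathsT i q (node (v ∷ vs)) at≡ =
      interior (nonleaf-reg i q at≡)
               (first-kid-nonleaf⇒¬penult i q at≡
                 (nonleaf-reg i (q ++ 0 ∷ []) (trans (subAt-++ (𝒦 i) q (0 ∷ []) at≡) (cong just (proj₂ (proj₂ (grow-nonleaf k' v)))))))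
               (blocks-pathsL i q 0 (v ∷ vs) (λ c → subAt-++ (𝒦 i) q (c ∷ []) at≡))

    blocks-pathsL : ∀ i q c₀ us → (∀ c → subAt (𝒦 i) (q ++ (c₀ + c) ∷ []) ≡ subAtL (growL k us) c []) →
                    Blocks (map (reg i) (pathsL q c₀ (growL k us)))
    blocks-pathsL i q c₀ [] _ = []
    blocks-pathsL i q c₀ (u ∷ us) us-at =
      subst Blocks (sym (map-++ (reg i) (pathsT (q ++ c₀ ∷ []) (grow k u)) (pathsL q (suc c₀) (growL k us))))
        (Blocks-++ (blocks-pathsT i (q ++ c₀ ∷ []) u u-at) (blocks-pathsL i q (suc c₀) us us-at'))
      where
        u-at : subAt (𝒦 i) (q ++ c₀ ∷ []) ≡ just (grow k u)
        u-at = subst (λ c → subAt (𝒦 i) (q ++ c ∷ []) ≡ just (grow k u)) (+-identityʳ c₀) (us-at 0)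
        us-at' : ∀ c → subAt (𝒦 i) (q ++ (suc c₀ + c) ∷ []) ≡ subAtL (growL k us) c []
        us-at' c = subst (λ c' → subAt (𝒦 i) (q ++ c' ∷ []) ≡ subAtL (growL k us) c []) (+-suc c₀ c) (us-at (suc c))

  traversal-blocks : ∀ i → p < i → Blocks (traversal i)
  traversal-blocks (suc zero) (s≤s p≤0) = case ≤-trans 2≤p p≤0 of λ ()
  traversal-blocks (suc (suc i)) p<i with 𝒦-grown p<i
  ... | b , bs , 𝒦≡ =
    interior refl (sup-¬penult i)
      (subst (λ G → Blocks (map (reg (suc (suc i))) (pathsL [] 0 (rootKids G)))) (sym 𝒦≡)
        (blocks-pathsL (suc (suc i)) [] 0 (b ∷ bs) (λ c → cong (λ G → subAt G (c ∷ [])) 𝒦≡)))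
    where
      sup-¬penult : ∀ i → isPenultK (sup (suc (suc i))) ≡ false
      sup-¬penult zero = refl
      sup-¬penult (suc i) = refl

  laterTraversals : ℕ → List Addr
  laterTraversals zero = []
  laterTraversals (suc r) = laterTraversals r ++ traversal (suc (p + r))

  seqK-split : ∀ r → seqK (p + r) ≡ seqK p ++ laterTraversals r
  seqK-split zero rewrite +-identityʳ p = sym (++-identityʳ (seqK p))
  seqK-split (suc r) rewrite +-suc p r | seqK-split r = ++-assoc (seqK p) (laterTraversals r) (traversal (suc (p + r)))

  laterTraversals-blocks : ∀ r → Blocks (laterTraversals r)
  laterTraversals-blocks zero = []
  laterTraversals-blocks (suc r) = Blocks-++ (laterTraversals-blocks r) (traversal-blocks (suc (p + r)) (s≤s (m≤m+n p r)))

  penultPart : Addr × ℕ → ℕ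
  penultPart (x , c) = if isPenultK x then c else 0

  prunedPart : Addr × ℕ → ℕ
  prunedPart (sup (suc zero) , _) = penultPart (sup 1 , j)
  prunedPart xc = penultPart xc

  keptPart : Addr × ℕ → ℕ
  keptPart (x , c) = if not (isLeafK x) then prunedPart (x , c) else 0

  prunedLeafLabels : List (Addr × ℕ) → ℕ
  prunedLeafLabels xs = sum (map keptPart xs)

  𝒫R≡prunedLeafLabels : ∀ n → 𝒫R n ≡ prunedLeafLabels 𝒦[ n ]
  𝒫R≡prunedLeafLabels n = trans (via-prune refl (λ { (sup zero) c → refl ; (sup (suc zero)) c → refl ; (sup (suc (suc i))) c → refl ; (reg i q) c → refl }))
                                 (sum-filter (λ xc → not (isLeafK (proj₁ xc))) prunedPart 𝒦[ n ])
    where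
      -- f is the relabelling local to 𝒫𝒦[_] in Defs; unification recovers it from refl.
      kept = filter (λ xc → not (isLeafK (proj₁ xc)) ≟ true) 𝒦[ n ]
      via-prune : ∀ {f : Addr × ℕ → Addr × ℕ} → 𝒫𝒦[ n ] ≡ map f kept → (∀ x c → penultPart (f (x , c)) ≡ prunedPart (x , c)) →
                  𝒫R n ≡ sum (map prunedPart kept)
      via-prune {f} 𝒫𝒦≡ f-prunes = trans (cong (λ L → sum (map penultPart L)) 𝒫𝒦≡) (go kept)
        where
          go : ∀ L → sum (map penultPart (map f L)) ≡ sum (map prunedPart L)
          go [] = refl
          go ((x , c) ∷ L) = cong₂ _+_ (f-prunes x c) (go L)

  whole-++ : ∀ xs ys → whole (xs ++ ys) ≡ whole xs ++ whole ys
  whole-++ = map-++ (λ x → x , nLabels x)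

  keptPart-¬penult : ∀ x c → isPenultK x ≡ false → keptPart (x , c) ≡ 0
  keptPart-¬penult (sup zero) c _ = refl
  keptPart-¬penult (sup (suc zero)) c ¬pen = case trans (sym sup1-penult) ¬pen of λ ()
  keptPart-¬penult (sup (suc (suc i))) c ¬pen rewrite ¬pen = refl
  keptPart-¬penult (reg i q) c ¬pen rewrite ¬pen with isLeafK (reg i q)
  ... | true = refl
  ... | false = refl

  keptPart-leaf : ∀ x c → isLeafK x ≡ true → keptPart (x , c) ≡ 0
  keptPart-leaf x c leaf = cong (λ b → if not b then prunedPart (x , c) else 0) leaf

  keptPart-penult-reg : ∀ i q c → isPenultK (reg i q) ≡ true → keptPart (reg i q , c) ≡ c
  keptPart-penult-reg i q c pen =
    trans (cong (λ b → if not b then penultPart (reg i q , c) else 0) (penult⇒¬leaf (reg i q) pen)) (cong (λ b → if b then c else 0) pen)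

  leafPart-nonleaf : ∀ x c → isLeafK x ≡ false → leafPart (x , c) ≡ 0
  leafPart-nonleaf x c nonleaf = cong (λ b → if b then c else 0) nonleaf

  module _ {cs : List Addr} (leaves : All FullLeaf cs) where
    labelCount-fullLeaves : labelCount cs ≡ length cs * j
    labelCount-fullLeaves = go leaves
      where
        go : ∀ {cs} → All FullLeaf cs → labelCount cs ≡ length cs * j
        go [] = refl
        go ((_ , n≡j) ∷ leaves) = cong₂ _+_ n≡j (go leaves)

    leafLabels-fullLeaves : leafLabels (whole cs) ≡ length cs * j
    leafLabels-fullLeaves = go leaves
      where
        go : ∀ {cs} → All FullLeaf cs → leafLabels (whole cs) ≡ length cs * j
        go [] = refl
        go {c ∷ _} ((leaf , n≡j) ∷ leaves) rewrite leaf = cong₂ _+_ n≡j (go leaves)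

    prunedLeafLabels-fullLeaves : prunedLeafLabels (whole cs) ≡ 0
    prunedLeafLabels-fullLeaves = go leaves
      where
        go : ∀ {cs} → All FullLeaf cs → prunedLeafLabels (whole cs) ≡ 0
        go [] = refl
        go {c ∷ _} ((leaf , _) ∷ leaves) = cong₂ _+_ (keptPart-leaf c (nLabels c) leaf) (go leaves)

    prefixFrom-fullLeaves : ∀ rest {u} → u ≤ labelCount cs →
                            leafLabels (prefixFrom u (cs ++ rest)) ≡ u × prunedLeafLabels (prefixFrom u (cs ++ rest)) ≡ 0
    prefixFrom-fullLeaves rest u≤ rewrite prefixFrom-++ˡ cs rest u≤ = go leaves u≤
      where
        go : ∀ {cs} → All FullLeaf cs → ∀ {u} → u ≤ labelCount cs →
             leafLabels (prefixFrom u cs) ≡ u × prunedLeafLabels (prefixFrom u cs) ≡ 0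
        go [] {zero} _ = refl , refl
        go (_ ∷ _) {zero} _ = refl , refl
        go {c ∷ cs} ((leaf , _) ∷ leaves) {suc u} u≤ with go leaves (m≤n+o⇒m∸n≤o (suc u) (nLabels c) u≤)
        ... | leaves≡ , pruned≡ =
          trans (cong₂ _+_ (cong (λ b → if b then nLabels c ⊓ suc u else 0) leaf) leaves≡) (m⊓n+n∸m≡n (nLabels c) (suc u))
          , cong₂ _+_ (keptPart-leaf c _ leaf) pruned≡

    nth-labelsOf-fullLeaves : ∀ rest {u} → u < labelCount cs → ∃ λ y → nth (labelsOf (cs ++ rest)) u ≡ just y × isLeafK y ≡ true
    nth-labelsOf-fullLeaves rest = go leaves
      where
        go : ∀ {cs} → All FullLeaf cs → ∀ {u} → u < labelCount cs → ∃ λ y → nth (labelsOf (cs ++ rest)) u ≡ just y × isLeafK y ≡ true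
        go {c ∷ cs} ((leaf , _) ∷ leaves) {u} u< with u <? nLabels c
        ... | yes u<n = c , nth-replicate-++ (nLabels c) c (labelsOf (cs ++ rest)) u<n , leaf
        ... | no u≮n with go leaves (+-cancelˡ-< (nLabels c) (u ∸ nLabels c) (labelCount cs)
                                 (subst (_< nLabels c + labelCount cs) (sym (m+[n∸m]≡n (≮⇒≥ u≮n))) u<))
        ...   | y , nth≡ , leafy =
          y , trans (cong (nth (labelsOf (c ∷ cs ++ rest))) (sym (m+[n∸m]≡n (≮⇒≥ u≮n))))
                    (trans (nth-replicate-++ʳ (nLabels c) c (labelsOf (cs ++ rest)) _) nth≡) , leafy

  leafLabels-blocks : ∀ {V} → Blocks V → leafLabels (whole V) ≡ k * prunedLeafLabels (whole V)
  leafLabels-blocks [] = sym (*-zeroʳ k)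
  leafLabels-blocks (interior {x} {xs} nonleaf ¬pen bxs) =
    trans (cong₂ _+_ (leafPart-nonleaf x (nLabels x) nonleaf) (leafLabels-blocks bxs))
          (cong (λ a → k * (a + prunedLeafLabels (whole xs))) (sym (keptPart-¬penult x (nLabels x) ¬pen)))
  leafLabels-blocks (family {i} {q} {cs} {xs} pen kids≡ len leaves bxs) = begin
    leafPart (reg i q , j) + leafLabels (whole (cs ++ xs))
      ≡⟨ cong₂ _+_ (leafPart-nonleaf (reg i q) j (penult⇒¬leaf (reg i q) pen))
                   (trans (cong leafLabels (whole-++ cs xs)) (sum-map-++ leafPart (whole cs) (whole xs))) ⟩
    leafLabels (whole cs) + leafLabels (whole xs)
      ≡⟨ cong₂ _+_ (trans (leafLabels-fullLeaves leaves) (cong (_* j) len)) (leafLabels-blocks bxs) ⟩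
    k * j + k * prunedLeafLabels (whole xs)
      ≡⟨ sym (*-distribˡ-+ k j _) ⟩
    k * (j + prunedLeafLabels (whole xs))
      ≡⟨ cong (k *_) (cong₂ _+_ (sym (keptPart-penult-reg i q j pen))
                                (sym (trans (cong prunedLeafLabels (whole-++ cs xs))
                                            (trans (sum-map-++ keptPart (whole cs) (whole xs))
                                                   (cong (_+ prunedLeafLabels (whole xs)) (prunedLeafLabels-fullLeaves leaves)))))) ⟩
    k * prunedLeafLabels (whole (reg i q ∷ cs ++ xs)) ∎
    where open ≡-Reasoning

  leafLabels-seqK-p : leafLabels (whole (seqK p)) ≡ α
  leafLabels-seqK-p = cong sum (sym (map-∘ (seqK p)))

  penultLabels : Addr → ℕ
  penultLabels x = if isPenultK x then nLabels x else 0

  prunedLeafLabels≡penultLabels : ∀ ys → All (sup 1 ≢_) ys → prunedLeafLabels (whole ys) ≡ sum (map penultLabels ys)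
  prunedLeafLabels≡penultLabels [] [] = refl
  prunedLeafLabels≡penultLabels (y ∷ ys) (y≢ ∷ ≢s) = cong₂ _+_ (kept≡penult y y≢) (prunedLeafLabels≡penultLabels ys ≢s)
    where
      kept≡penult : ∀ y → sup 1 ≢ y → keptPart (y , nLabels y) ≡ penultLabels y
      kept≡penult (sup zero) _ = refl
      kept≡penult (sup (suc zero)) ≢ = ⊥-elim (≢ refl)
      kept≡penult (sup (suc (suc i))) _ = refl
      kept≡penult (reg i q) _ with isLeafK (reg i q) in leaf
      ... | true = refl
      ... | false = refl

  prunedLeafLabels-seqK-p : prunedLeafLabels (whole (seqK p)) + s ≡ β + j
  prunedLeafLabels-seqK-p = split (seqK-prefix 1≤p) (seqK-unique p)
    where
      split : ∀ {L} → (∃ λ Z → L ≡ seqK 1 ++ Z) → Unique L → prunedLeafLabels (whole L) + s ≡ sum (map penultLabels L) + j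
      split (Z , refl) (_ ∷ sup1∉ ∷ _) = begin
        keptPart (sup 1 , s) + prunedLeafLabels (whole Y) + s  ≡⟨ cong (λ a → a + prunedLeafLabels (whole Y) + s) (cong (λ b → if b then j else 0) sup1-penult) ⟩
        j + prunedLeafLabels (whole Y) + s                     ≡⟨ cong (λ a → j + a + s) (prunedLeafLabels≡penultLabels Y sup1∉) ⟩
        j + Q + s                                              ≡⟨ trans (+-comm (j + Q) s) (trans (cong (s +_) (+-comm j Q)) (sym (+-assoc s Q j))) ⟩
        s + Q + j                                              ≡⟨ cong (λ a → a + Q + j) (sym (cong (λ b → if b then s else 0) sup1-penult)) ⟩
        penultLabels (sup 1) + Q + j                           ∎
        where
          open ≡-Reasoning
          Y = map (reg 1) (pathsL [] 1 (rootKids (base 1))) ++ Z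
          Q = sum (map penultLabels Y)

  PenultClosed : List Addr → Set
  PenultClosed X = All (λ x → isPenultK x ≡ true → All (_∈ X) (kidsK x)) X

  PenultClosed-++ : ∀ {X Y} → PenultClosed X → PenultClosed Y → PenultClosed (X ++ Y)
  PenultClosed-++ {X} cX cY =
    All.++⁺ (All.map (λ kids pen → All.map ∈-++⁺ˡ (kids pen)) cX) (All.map (λ kids pen → All.map (∈-++⁺ʳ X) (kids pen)) cY)

  seqK-penultClosed : ∀ i → PenultClosed (seqK i)
  seqK-penultClosed i = All.map (λ kids _ → kids) (seqK-children-closed i)

  blocks-penultClosed : ∀ {V} → Blocks V → PenultClosed V
  blocks-penultClosed [] = []
  blocks-penultClosed (interior _ ¬pen bxs) =
    (λ pen → case trans (sym ¬pen) pen of λ ()) ∷ All.map (λ kids pen → All.map there (kids pen)) (blocks-penultClosed bxs)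
  blocks-penultClosed (family {i} {q} {cs} {xs} _ kids≡ _ leaves bxs) =
    (λ _ → subst (All (_∈ reg i q ∷ cs ++ xs)) (sym kids≡) (All.tabulate (λ c∈ → there (∈-++⁺ˡ c∈))))
    ∷ All.++⁺ (All.map (λ {c} (leaf , _) pen → case trans (sym (leaf⇒¬penult c leaf)) pen of λ ()) leaves)
              (All.map (λ kids pen → All.map (λ y∈ → there (∈-++⁺ʳ cs y∈)) (kids pen)) (blocks-penultClosed bxs))

  complete-if-closed : ∀ {m} X Tl → 𝒦[ m ] ≡ whole X ++ Tl → PenultClosed X →
                       All (λ xc → isPenultK (proj₁ xc) ≡ false) Tl → Complete m
  complete-if-closed {m} X Tl 𝒦≡ cX ¬pens = subst (λ P → All (λ xc → T (isPenultK (proj₁ xc)) → All (λ c → (c , nLabels c) ∈ P) (kidsK (proj₁ xc))) P)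
    (sym 𝒦≡)
    (All.++⁺ (All.map⁺ (All.map (λ kids t → All.map (λ c∈ → ∈-++⁺ˡ (∈-map⁺ (λ y → y , nLabels y) c∈)) (kids (Equivalence.to T-≡ t))) cX))
             (All.map (λ ¬pen t → ⊥-elim (subst T ¬pen t)) ¬pens))

  -- The last child c of the family is cut off; as c occurs only once in the traversal, it is missing from 𝒦(m).
  incomplete-if-cut : ∀ {m} X i q cs c rest {o} → 𝒦[ m ] ≡ whole X ++ prefixFrom o ((reg i q ∷ cs) ++ c ∷ rest) →
                      1 ≤ o → o < labelCount (reg i q ∷ cs) + nLabels c → isPenultK (reg i q) ≡ true →
                      kidsK (reg i q) ≡ cs ++ c ∷ [] → Unique (X ++ (reg i q ∷ cs) ++ c ∷ rest) → ¬ Complete m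
  incomplete-if-cut {m} X i q cs c rest {o} 𝒦≡ 1≤o cut pen kids≡ unique complete = absurd (∈-++⁻ (whole X) c∈)
    where
      B = reg i q ∷ cs
      c∉ : ¬ (c ∈ X ++ B)
      c∉ c∈ = unique-++-disjoint (X ++ B) (subst Unique (sym (++-assoc X B (c ∷ rest))) unique) c∈ (here refl)
      prefix-head : ∀ o → 1 ≤ o → prefixFrom o (B ++ c ∷ rest) ≡ (reg i q , nLabels (reg i q) ⊓ o) ∷ prefixFrom (o ∸ j) (cs ++ c ∷ rest)
      prefix-head (suc o) _ = refl
      node∈ : (reg i q , nLabels (reg i q) ⊓ o) ∈ 𝒦[ m ]
      node∈ = subst (_ ∈_) (sym 𝒦≡) (∈-++⁺ʳ (whole X) (subst (_ ∈_) (sym (prefix-head o 1≤o)) (here refl)))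
      c∈ : (c , nLabels c) ∈ whole X ++ prefixFrom o (B ++ c ∷ rest)
      c∈ = subst (_ ∈_) 𝒦≡ (All.lookup (subst (All _) kids≡ (All.lookup complete node∈ (Equivalence.from T-≡ pen))) (∈-++⁺ʳ cs (here refl)))
      absurd : (c , nLabels c) ∈ whole X ⊎ (c , nLabels c) ∈ prefixFrom o (B ++ c ∷ rest) → ⊥
      absurd (inj₁ c∈X) with ∈-map⁻ _ c∈X
      ... | _ , c∈ , refl = c∉ (∈-++⁺ˡ c∈)
      absurd (inj₂ c∈prefix) with ∈-prefixFrom-cut B c rest cut c∈prefix
      ... | inj₁ c∈B = c∉ (∈-++⁺ʳ X c∈B)
      ... | inj₂ (_ , n<n) = <-irrefl refl n<n

  record InteriorPosition (W : List Addr) (t : ℕ) : Set where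
    field
      before : List Addr
      x : Addr
      after : List Addr
      offset : ℕ
      split : W ≡ before ++ x ∷ after
      before-blocks : Blocks before
      nonleaf : isLeafK x ≡ false
      ¬penult : isPenultK x ≡ false
      t≡ : t ≡ labelCount before + offset
      1≤offset : 1 ≤ offset
      offset≤ : offset ≤ nLabels x

  record FamilyPosition (W : List Addr) (t : ℕ) : Set where
    field
      before : List Addr
      i : ℕ
      q : List ℕ
      kids : List Addr
      after : List Addr
      offset : ℕ
      split : W ≡ before ++ (reg i q ∷ kids) ++ after
      before-blocks : Blocks before
      penult : isPenultK (reg i q) ≡ true
      kids≡ : kidsK (reg i q) ≡ kids
      #kids : length kids ≡ k
      full-leaves : All FullLeaf kids
      t≡ : t ≡ labelCount before + offset
      1≤offset : 1 ≤ offset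
      offset≤ : offset ≤ j + labelCount kids

  Position : List Addr → ℕ → Set
  Position W t = InteriorPosition W t ⊎ FamilyPosition W t

  labelCount-step : ∀ V B {o} → labelCount B ≤ o → labelCount (V ++ B) + (o ∸ labelCount B) ≡ labelCount V + o
  labelCount-step V B {o} B≤o = begin
    labelCount (V ++ B) + (o ∸ labelCount B)          ≡⟨ cong (_+ (o ∸ labelCount B)) (labelCount-++ V B) ⟩
    labelCount V + labelCount B + (o ∸ labelCount B)  ≡⟨ +-assoc (labelCount V) _ _ ⟩
    labelCount V + (labelCount B + (o ∸ labelCount B)) ≡⟨ cong (labelCount V +_) (m+[n∸m]≡n B≤o) ⟩
    labelCount V + o                                   ∎
    where open ≡-Reasoning

  mutual
    locate : ∀ {V W} → Blocks V → Blocks W → ∀ {o} → 1 ≤ o → o ≤ labelCount W → Position (V ++ W) (labelCount V + o)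
    locate bV [] 1≤o o≤0 = case ≤-trans 1≤o o≤0 of λ ()
    locate {V} bV (interior {x} {xs} nonleaf ¬penult bxs) {o} 1≤o o≤ with o ≤? labelCount (x ∷ [])
    ... | yes o≤n = inj₁ (record { before = V ; x = x ; after = xs ; offset = o ; split = refl ; before-blocks = bV
                                 ; nonleaf = nonleaf ; ¬penult = ¬penult ; t≡ = refl ; 1≤offset = 1≤o
                                 ; offset≤ = subst (o ≤_) (+-identityʳ (nLabels x)) o≤n })
    ... | no o≰n = descend (x ∷ []) bV (interior nonleaf ¬penult []) bxs o≰n o≤
    locate {V} bV (family {i} {q} {cs} {xs} penult kids≡ #kids leaves bxs) {o} 1≤o o≤ with o ≤? labelCount (reg i q ∷ cs)
    ... | yes o≤n = inj₂ (record { before = V ; i = i ; q = q ; kids = cs ; after = xs ; offset = o ; split = refl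
                                 ; before-blocks = bV ; penult = penult ; kids≡ = kids≡ ; #kids = #kids ; full-leaves = leaves
                                 ; t≡ = refl ; 1≤offset = 1≤o ; offset≤ = o≤n })
    ... | no o≰n = descend (reg i q ∷ cs) bV bB bxs o≰n o≤
      where
        bB : Blocks (reg i q ∷ cs)
        bB = subst (λ ys → Blocks (reg i q ∷ ys)) (++-identityʳ cs) (family penult kids≡ #kids leaves [])

    descend : ∀ {V xs} B → Blocks V → Blocks B → Blocks xs → ∀ {o} → ¬ (o ≤ labelCount B) → o ≤ labelCount (B ++ xs) →
              Position (V ++ B ++ xs) (labelCount V + o)
    descend {V} {xs} B bV bB bxs {o} o≰ o≤ =
      subst₂ Position (++-assoc V B xs) (labelCount-step V B (<⇒≤ (≰⇒> o≰)))
        (locate (Blocks-++ bV bB) bxs (m<n⇒0<n∸m (≰⇒> o≰)) (m≤n+o⇒m∸n≤o o (labelCount B) (subst (o ≤_) (labelCount-++ B xs) o≤)))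

  IsΔ-unique : ∀ {n d d'} → IsΔ n d → IsΔ n d' → d ≡ d'
  IsΔ-unique {d = d} {d'} (complete , least) (complete' , least') with <-cmp d d'
  ... | tri< d<d' _ _ = ⊥-elim (least' d d<d' complete)
  ... | tri≈ _ d≡d' _ = d≡d'
  ... | tri> _ _ d'<d = ⊥-elim (least d' d'<d complete')

  labelCount-seqK-mono : ∀ {a b} → a ≤ b → labelCount (seqK a) ≤ labelCount (seqK b)
  labelCount-seqK-mono {a} a≤b with seqK-prefix a≤b
  ... | Z , seqK≡ = subst (labelCount (seqK a) ≤_) (sym (trans (cong labelCount seqK≡) (labelCount-++ (seqK a) Z))) (m≤m+n _ _)

  module Main (n : ℕ) (N<n : N (p + 1) < n) where
    S : List Addr
    S = seqK p

    w : ℕ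
    w = j + k * j

    -- every label up to n + w lies in 𝒦_1, …, 𝒦_M
    M : ℕ
    M = suc (n + w)

    later : List Addr
    later = laterTraversals (M ∸ p)

    S<n : labelCount S < n
    S<n = ≤-<-trans (labelCount-seqK-mono (m≤m+n p 1)) N<n

    seqK-M : seqK M ≡ S ++ later
    seqK-M = trans (cong seqK (sym (m+[n∸m]≡n p≤M))) (seqK-split (M ∸ p))
      where
        p≤M : p ≤ M
        p≤M = ≤-trans (i≤labelCount-seqK p) (≤-trans (<⇒≤ S<n) (m≤n⇒m≤1+n (m≤m+n n w)))

    t : ℕ
    t = n ∸ labelCount S

    n≡ : n ≡ labelCount S + t
    n≡ = sym (m+[n∸m]≡n (<⇒≤ S<n))

    position : Position later t
    position = locate [] (laterTraversals-blocks (M ∸ p)) (m<n⇒0<n∸m S<n)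
      (m≤n+o⇒m∸n≤o n (labelCount S) (subst (n ≤_) (trans (cong labelCount seqK-M) (labelCount-++ S later))
                                                   (≤-trans (m≤n⇒m≤1+n (m≤m+n n w)) (i≤labelCount-seqK M))))

    𝒦-split : ∀ X B rest {o} → seqK M ≡ X ++ B ++ rest → 1 ≤ o → labelCount X + o < M →
              𝒦[ labelCount X + o ] ≡ whole X ++ prefixFrom o (B ++ rest)
    𝒦-split X B rest seqK≡ 1≤o m<M =
      trans (𝒦[]≡prefixFrom m<M) (trans (cong (prefixFrom _) seqK≡) (prefixFrom-++ʳ X (B ++ rest) 1≤o))

    R≡leafLabels-𝒦 : R n ≡ leafLabels 𝒦[ n ]
    R≡leafLabels-𝒦 = trans (R≡leafLabels (seqK M) n (λ ℓ ℓ<n → labelNode≡nth (s≤s (≤-trans ℓ<n (m≤m+n n w)))))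
                           (cong leafLabels (sym (𝒦[]≡prefixFrom (s≤s (m≤m+n n w)))))

    [k+1]j≡w : (k + 1) * j ≡ w
    [k+1]j≡w = trans (*-distribʳ-+ j k 1) (trans (cong (k * j +_) (*-identityˡ j)) (+-comm (k * j) j))

    cut-point : ∀ before {o} → t ≡ labelCount before + o → n ≡ labelCount (S ++ before) + o
    cut-point before {o} t≡ = begin
      n                                          ≡⟨ n≡ ⟩
      labelCount S + t                           ≡⟨ cong (labelCount S +_) t≡ ⟩
      labelCount S + (labelCount before + o)     ≡⟨ sym (+-assoc (labelCount S) _ o) ⟩
      labelCount S + labelCount before + o       ≡⟨ cong (_+ o) (sym (labelCount-++ S before)) ⟩
      labelCount (S ++ before) + o               ∎
      where open ≡-Reasoning

    seqK-M-split : ∀ before B rest → later ≡ before ++ B ++ rest → seqK M ≡ (S ++ before) ++ B ++ rest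
    seqK-M-split before B rest later≡ = trans seqK-M (trans (cong (S ++_) later≡) (sym (++-assoc S before (B ++ rest))))

    module _ where
      open import Data.Integer using (+_; _-_) renaming (_*_ to _*ℤ_; _+_ to _+ℤ_)
      open import Data.Integer.Properties using (pos-*) renaming (+-identityʳ to +ℤ-identityʳ)
      open import Data.Nat.Tactic.RingSolver using (solve-∀)
      open import Function.Bundles using (_⇔_; mk⇔)

      module Counting (V : List Addr) (Tl : List (Addr × ℕ)) (bV : Blocks V) (𝒦≡ : 𝒦[ n ] ≡ whole (S ++ V) ++ Tl) where
        P₀ PV PT LT : ℕ
        P₀ = prunedLeafLabels (whole S)
        PV = prunedLeafLabels (whole V)
        PT = prunedLeafLabels Tl
        LT = leafLabels Tl

        𝒫R-split : 𝒫R n ≡ P₀ + PV + PT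
        𝒫R-split = trans (𝒫R≡prunedLeafLabels n) (trans (cong prunedLeafLabels 𝒦≡)
                (trans (sum-map-++ keptPart (whole (S ++ V)) Tl)
                       (cong (λ a → a + PT) (trans (cong prunedLeafLabels (whole-++ S V)) (sum-map-++ keptPart (whole S) (whole V))))))

        R-split : R n ≡ α + k * PV + LT
        R-split = trans R≡leafLabels-𝒦 (trans (cong leafLabels 𝒦≡) (trans (sum-map-++ leafPart (whole (S ++ V)) Tl)
                (cong (λ a → a + LT) (trans (cong leafLabels (whole-++ S V))
                  (trans (sum-map-++ leafPart (whole S) (whole V)) (cong₂ _+_ leafLabels-seqK-p (leafLabels-blocks bV)))))))

        ν≡ : ν ≡ + α - + (k * P₀)
        ν≡ = trans (cong (λ z → + α - + k *ℤ z) (pos-minus-plus P₀ β s j prunedLeafLabels-seqK-p))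
                   (cong (λ z → + α - z) (sym (pos-* k P₀)))

        formula-≤ : ∀ d → k * PT ≡ LT + d → + k *ℤ + 𝒫R n ≡ (+ R n +ℤ + d) - ν
        formula-≤ d kPT≡ = begin
          + k *ℤ + 𝒫R n                               ≡⟨ sym (pos-* k (𝒫R n)) ⟩
          + (k * 𝒫R n)                                ≡⟨ pos-rearrange (k * 𝒫R n) (R n + d) α (k * P₀) 0 counted ⟩
          (+ (R n + d) - (+ α - + (k * P₀))) - + 0    ≡⟨ +ℤ-identityʳ _ ⟩
          + (R n + d) - (+ α - + (k * P₀))            ≡⟨ cong (λ z → + (R n + d) - z) (sym ν≡) ⟩
          (+ R n +ℤ + d) - ν                          ∎
          where
            open ≡-Reasoning
            counted : k * 𝒫R n + α + 0 ≡ R n + d + k * P₀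
            counted = begin
              k * 𝒫R n + α + 0                  ≡⟨ cong (λ z → k * z + α + 0) 𝒫R-split ⟩
              k * (P₀ + PV + PT) + α + 0        ≡⟨ expand k P₀ PV PT α ⟩
              k * P₀ + k * PV + k * PT + α      ≡⟨ cong (λ z → k * P₀ + k * PV + z + α) kPT≡ ⟩
              k * P₀ + k * PV + (LT + d) + α    ≡⟨ regroup k P₀ PV LT d α ⟩
              α + k * PV + LT + d + k * P₀      ≡⟨ cong (λ z → z + d + k * P₀) (sym R-split) ⟩
              R n + d + k * P₀                  ∎
              where
                expand : ∀ k a b c α → k * (a + b + c) + α + 0 ≡ k * a + k * b + k * c + α
                expand = solve-∀
                regroup : ∀ k a b l d α → k * a + k * b + (l + d) + α ≡ α + k * b + l + d + k * a
                regroup = solve-∀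

        formula-> : ∀ o e → PT ≡ o → LT ≡ 0 → o + e ≡ j →
                    + k *ℤ + 𝒫R n ≡ ((+ R n +ℤ + (k * j)) - ν) - + k *ℤ (+ (k * j + e) - + (k * j))
        formula-> o e PT≡ LT≡0 o+e≡j = begin
          + k *ℤ + 𝒫R n                                              ≡⟨ sym (pos-* k (𝒫R n)) ⟩
          + (k * 𝒫R n)                                               ≡⟨ pos-rearrange (k * 𝒫R n) (R n + k * j) α (k * P₀) (k * e) counted ⟩
          (+ (R n + k * j) - (+ α - + (k * P₀))) - + (k * e)         ≡⟨ cong₂ (λ a b → (+ (R n + k * j) - a) - b) (sym ν≡) (pos-* k e) ⟩
          (+ (R n + k * j) - ν) - + k *ℤ + e                         ≡⟨ cong (λ z → (+ (R n + k * j) - ν) - + k *ℤ z) (sym (pos-+-minus (k * j) e)) ⟩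
          ((+ R n +ℤ + (k * j)) - ν) - + k *ℤ (+ (k * j + e) - + (k * j)) ∎
          where
            open ≡-Reasoning
            counted : k * 𝒫R n + α + k * e ≡ R n + k * j + k * P₀
            counted = begin
              k * 𝒫R n + α + k * e                ≡⟨ cong (λ z → k * z + α + k * e) 𝒫R-split ⟩
              k * (P₀ + PV + PT) + α + k * e      ≡⟨ expand k P₀ PV PT e α ⟩
              k * P₀ + k * PV + k * (PT + e) + α  ≡⟨ cong (λ z → k * P₀ + k * PV + k * z + α) (trans (cong (_+ e) PT≡) o+e≡j) ⟩
              k * P₀ + k * PV + k * j + α         ≡⟨ regroup k P₀ PV j α ⟩
              α + k * PV + 0 + k * j + k * P₀     ≡⟨ cong (λ z → α + k * PV + z + k * j + k * P₀) (sym LT≡0) ⟩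
              α + k * PV + LT + k * j + k * P₀    ≡⟨ cong (λ z → z + k * j + k * P₀) (sym R-split) ⟩
              R n + k * j + k * P₀                ∎
              where
                expand : ∀ k a b c e α → k * (a + b + c) + α + k * e ≡ k * a + k * b + k * (c + e) + α
                expand = solve-∀
                regroup : ∀ k a b j α → k * a + k * b + k * j + α ≡ α + k * b + 0 + k * j + k * a
                regroup = solve-∀

      Conclusion : Set
      Conclusion = ((¬ LeafLabel n → ¬ PenultLabel n → Complete n)
                     × ∃ (λ d → IsΔ n d × d < (k + 1) * j))
                 × (∀ d → IsΔ n d → d > 0 →
                     ((d < k * j) ⇔ LeafLabel n) × ((k * j ≤ d) ⇔ PenultLabel n))
                 × (∀ d → IsΔ n d → d ≤ k * j →
                     + k *ℤ + 𝒫R n ≡ (+ R n +ℤ + d) - ν)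
                 × (∀ d → IsΔ n d → d > k * j →
                     + k *ℤ + 𝒫R n ≡ ((+ R n +ℤ + (k * j)) - ν) - + k *ℤ (+ d - + (k * j)))

      conclusion-from-Δ : ∀ Δ → IsΔ n Δ → Δ < (k + 1) * j →
        (¬ LeafLabel n → ¬ PenultLabel n → Complete n) →
        (Δ > 0 → ((Δ < k * j) ⇔ LeafLabel n) × ((k * j ≤ Δ) ⇔ PenultLabel n)) →
        (Δ ≤ k * j → + k *ℤ + 𝒫R n ≡ (+ R n +ℤ + Δ) - ν) →
        (Δ > k * j → + k *ℤ + 𝒫R n ≡ ((+ R n +ℤ + (k * j)) - ν) - + k *ℤ (+ Δ - + (k * j))) →
        Conclusion
      conclusion-from-Δ Δ isΔ Δ< complete kind formula-≤ formula-> =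
        (complete , Δ , isΔ , Δ<) , (λ d isΔd → at isΔd kind) , (λ d isΔd → at isΔd formula-≤) , (λ d isΔd → at isΔd formula->)
        where
          at : ∀ {d} {A : ℕ → Set} → IsΔ n d → A Δ → A d
          at {A = A} isΔd = subst A (IsΔ-unique isΔ isΔd)

      at-interior : InteriorPosition later t → Conclusion
      at-interior pos = conclusion-from-Δ 0 isΔ (s≤s z≤n) (λ _ _ → complete) (λ ()) (λ _ → formula-≤ 0 no-surplus) (λ ())
        where
          open InteriorPosition pos
          Tl = (x , offset) ∷ []
          n≡' = cut-point before t≡
          𝒦≡ : 𝒦[ n ] ≡ whole (S ++ before) ++ Tl
          𝒦≡ = subst (λ m → 𝒦[ m ] ≡ whole (S ++ before) ++ Tl) (sym n≡')
                 (trans (𝒦-split (S ++ before) (x ∷ []) after (seqK-M-split before (x ∷ []) after split) 1≤offset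
                                 (subst (_< M) n≡' (s≤s (m≤m+n n w))))
                        (cong (whole (S ++ before) ++_) (prefixFrom-inside x after 1≤offset offset≤)))
          open Counting before Tl before-blocks 𝒦≡
          complete : Complete n
          complete = complete-if-closed (S ++ before) Tl 𝒦≡
                       (PenultClosed-++ (seqK-penultClosed p) (blocks-penultClosed before-blocks)) (¬penult ∷ [])
          isΔ : IsΔ n 0
          isΔ = subst Complete (sym (+-identityʳ n)) complete , λ _ ()
          no-surplus : k * PT ≡ LT + 0
          no-surplus = trans (cong (λ a → k * (a + 0)) (keptPart-¬penult x offset ¬penult))
                             (trans (*-zeroʳ k) (sym (cong (λ a → a + 0 + 0) (leafPart-nonleaf x offset nonleaf))))

      module Family (pos : FamilyPosition later t) where
        open FamilyPosition pos

        X B : List Addr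
        X = S ++ before
        B = reg i q ∷ kids

        o : ℕ
        o = offset

        n≡' : n ≡ labelCount X + o
        n≡' = cut-point before t≡

        seqK≡ : seqK M ≡ X ++ B ++ after
        seqK≡ = seqK-M-split before B after split

        kids-labels : labelCount kids ≡ k * j
        kids-labels = trans (labelCount-fullLeaves full-leaves) (cong (λ m → m * j) #kids)

        B-labels : labelCount B ≡ w
        B-labels = cong (λ m → j + m) kids-labels

        o≤w : o ≤ w
        o≤w = subst (o ≤_) B-labels offset≤

        Δ : ℕ
        Δ = w ∸ o

        𝒦-at : ∀ {o'} → 1 ≤ o' → o' ≤ w → 𝒦[ labelCount X + o' ] ≡ whole X ++ prefixFrom o' (B ++ after)
        𝒦-at 1≤o' o'≤w = 𝒦-split X B after seqK≡ 1≤o'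
          (s≤s (+-mono-≤ (subst (labelCount X ≤_) (sym n≡') (m≤m+n (labelCount X) o)) o'≤w))

        complete-after : Complete (n + Δ)
        complete-after = subst Complete (sym n+Δ≡) (complete-if-closed (X ++ B) [] 𝒦≡
          (PenultClosed-++ (PenultClosed-++ (seqK-penultClosed p) (blocks-penultClosed before-blocks))
                           (subst PenultClosed (++-identityʳ B) (blocks-penultClosed (family penult kids≡ #kids full-leaves [])))) [])
          where
            n+Δ≡ : n + Δ ≡ labelCount X + labelCount B
            n+Δ≡ = trans (cong (λ m → m + Δ) n≡') (trans (+-assoc (labelCount X) o Δ)
                         (cong (λ m → labelCount X + m) (trans (m+[n∸m]≡n o≤w) (sym B-labels))))
            labelled : All (λ x → 1 ≤ nLabels x) B
            labelled = s≤s z≤n ∷ All.map (λ (_ , n≡j) → subst (1 ≤_) (sym n≡j) (s≤s z≤n)) full-leaves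
            𝒦≡ : 𝒦[ labelCount X + labelCount B ] ≡ whole (X ++ B) ++ []
            𝒦≡ = trans (subst (λ m → 𝒦[ labelCount X + m ] ≡ whole X ++ prefixFrom m (B ++ after)) (sym B-labels)
                               (𝒦-at (≤-trans (s≤s z≤n) (m≤m+n j (k * j))) ≤-refl))
                       (trans (cong (whole X ++_) (prefixFrom-labelCount B after labelled))
                              (sym (trans (++-identityʳ _) (whole-++ X B))))

        incomplete-before : ∀ d' → d' < Δ → ¬ Complete (n + d')
        incomplete-before d' d'<Δ with ∷ʳ-view kids (subst (0 <_) (sym #kids) (s≤s z≤n))
        ... | kids' , c , kids≡' =
          incomplete-if-cut X i q kids' c after 𝒦≡ (≤-trans 1≤offset (m≤m+n o d')) cut penult (trans kids≡ kids≡')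
            (subst Unique (trans seqK≡ (cong (X ++_) B++after≡)) (seqK-unique M))
          where
            B++after≡ : B ++ after ≡ (reg i q ∷ kids') ++ c ∷ after
            B++after≡ = cong (reg i q ∷_) (trans (cong (_++ after) kids≡') (++-assoc kids' (c ∷ []) after))
            o+d'<w : o + d' < w
            o+d'<w = subst (o + d' <_) (m+[n∸m]≡n o≤w) (+-monoʳ-< o d'<Δ)
            cut : o + d' < labelCount (reg i q ∷ kids') + nLabels c
            cut = subst (o + d' <_) (begin
              w                                         ≡⟨ sym B-labels ⟩
              j + labelCount kids                       ≡⟨ cong (λ cs → j + labelCount cs) kids≡' ⟩
              j + labelCount (kids' ++ c ∷ [])          ≡⟨ cong (λ m → j + m) (labelCount-++ kids' (c ∷ [])) ⟩
              j + (labelCount kids' + (nLabels c + 0))  ≡⟨ cong (λ m → j + (labelCount kids' + m)) (+-identityʳ (nLabels c)) ⟩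
              j + (labelCount kids' + nLabels c)        ≡⟨ sym (+-assoc j (labelCount kids') (nLabels c)) ⟩
              labelCount (reg i q ∷ kids') + nLabels c  ∎) o+d'<w
              where open ≡-Reasoning
            𝒦≡ : 𝒦[ n + d' ] ≡ whole X ++ prefixFrom (o + d') ((reg i q ∷ kids') ++ c ∷ after)
            𝒦≡ = trans (cong 𝒦[_] (trans (cong (λ m → m + d') n≡') (+-assoc (labelCount X) o d')))
                       (trans (𝒦-at (≤-trans 1≤offset (m≤m+n o d')) (<⇒≤ o+d'<w))
                              (cong (λ L → whole X ++ prefixFrom (o + d') L) B++after≡))

        isΔ : IsΔ n Δ
        isΔ = complete-after , incomplete-before

        labelNode-n : labelNode n ≡ nth (labelsOf (B ++ after)) (o ∸ 1)
        labelNode-n = begin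
          labelNode n                                         ≡⟨ cong labelNode n≡suc ⟩
          labelNode (suc (labelCount X + (o ∸ 1)))            ≡⟨ labelNode≡nth (subst (_< M) n≡suc (s≤s (m≤m+n n w))) ⟩
          nth (labelsOf (seqK M)) (labelCount X + (o ∸ 1))    ≡⟨ cong (λ L → nth (labelsOf L) (labelCount X + (o ∸ 1))) seqK≡ ⟩
          nth (labelsOf (X ++ B ++ after)) (labelCount X + (o ∸ 1)) ≡⟨ nth-labelsOf-++ʳ X (B ++ after) (o ∸ 1) ⟩
          nth (labelsOf (B ++ after)) (o ∸ 1)                 ∎
          where
            open ≡-Reasoning
            n≡suc : n ≡ suc (labelCount X + (o ∸ 1))
            n≡suc = trans n≡' (trans (cong (λ m → labelCount X + m) (sym (m+[n∸m]≡n 1≤offset))) (+-suc (labelCount X) (o ∸ 1)))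

        kj≡w∸j : k * j ≡ w ∸ j
        kj≡w∸j = sym (m+n∸m≡n j (k * j))

        Δ<[k+1]j : Δ < (k + 1) * j
        Δ<[k+1]j = subst (Δ <_) (sym [k+1]j≡w) (∸-monoʳ-< {o = 0} 1≤offset o≤w)

        in-penultimate : o ≤ j → Conclusion
        in-penultimate o≤j = conclusion-from-Δ Δ isΔ Δ<[k+1]j (λ _ ¬pen → ⊥-elim (¬pen penultLabel)) kind
                               (λ Δ≤kj → formula-≤ Δ (surplus Δ≤kj)) excess
          where
            node≡ : labelNode n ≡ just (reg i q)
            node≡ = trans labelNode-n (nth-replicate-++ j (reg i q) (labelsOf (kids ++ after))
                                                        (<-≤-trans (∸-monoʳ-< {o = 0} (s≤s z≤n) 1≤offset) o≤j))
            penultLabel : PenultLabel n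
            penultLabel = subst T (sym (trans (cong (maybe isPenultK false) node≡) penult)) tt
            ¬leafLabel : ¬ LeafLabel n
            ¬leafLabel = subst T (trans (cong (maybe isLeafK false) node≡) (penult⇒¬leaf (reg i q) penult))
            kj≤Δ : k * j ≤ Δ
            kj≤Δ = subst (_≤ Δ) (sym kj≡w∸j) (∸-monoʳ-≤ w o≤j)
            kind : Δ > 0 → ((Δ < k * j) ⇔ LeafLabel n) × ((k * j ≤ Δ) ⇔ PenultLabel n)
            kind _ = mk⇔ (λ Δ<kj → ⊥-elim (<⇒≱ Δ<kj kj≤Δ)) (λ leaf → ⊥-elim (¬leafLabel leaf)) , mk⇔ (λ _ → penultLabel) (λ _ → kj≤Δ)
            Tl = (reg i q , o) ∷ []
            𝒦≡ : 𝒦[ n ] ≡ whole X ++ Tl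
            𝒦≡ = trans (cong 𝒦[_] n≡') (trans (𝒦-at 1≤offset o≤w) (cong (whole X ++_) (prefixFrom-inside (reg i q) (kids ++ after) 1≤offset o≤j)))
            open Counting before Tl before-blocks 𝒦≡
            PT≡o : PT ≡ o
            PT≡o = trans (cong (λ a → a + 0) (keptPart-penult-reg i q o penult)) (+-identityʳ o)
            LT≡0 : LT ≡ 0
            LT≡0 = cong (λ a → a + 0) (leafPart-nonleaf (reg i q) o (penult⇒¬leaf (reg i q) penult))
            -- Δ ≤ kj forces Δ = kj and hence o = j.
            surplus : Δ ≤ k * j → k * PT ≡ LT + Δ
            surplus Δ≤kj = begin
              k * PT   ≡⟨ cong (k *_) (trans PT≡o o≡j) ⟩
              k * j    ≡⟨ sym Δ≡kj ⟩
              Δ        ≡⟨ cong (λ a → a + Δ) (sym LT≡0) ⟩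
              LT + Δ   ∎
              where
                open ≡-Reasoning
                Δ≡kj = ≤-antisym Δ≤kj kj≤Δ
                o≡j : o ≡ j
                o≡j = +-cancelʳ-≡ Δ o j (trans (m+[n∸m]≡n o≤w) (cong (λ m → j + m) (sym Δ≡kj)))
            excess : Δ > k * j → + k *ℤ + 𝒫R n ≡ ((+ R n +ℤ + (k * j)) - ν) - + k *ℤ (+ Δ - + (k * j))
            excess _ = subst (λ d → + k *ℤ + 𝒫R n ≡ ((+ R n +ℤ + (k * j)) - ν) - + k *ℤ (+ d - + (k * j))) (sym Δ≡)
                         (formula-> o (j ∸ o) PT≡o LT≡0 (m+[n∸m]≡n o≤j))
              where
                Δ≡ : Δ ≡ k * j + (j ∸ o)
                Δ≡ = trans (cong (_∸ o) (+-comm j (k * j))) (+-∸-assoc (k * j) o≤j)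

        in-leaf : j < o → Conclusion
        in-leaf j<o = conclusion-from-Δ Δ isΔ Δ<[k+1]j (λ ¬leaf _ → ⊥-elim (¬leaf leafLabel)) kind
                        (λ _ → formula-≤ Δ surplus) (λ kj<Δ → ⊥-elim (<⇒≱ kj<Δ (<⇒≤ Δ<kj)))
          where
            u = o ∸ 1 ∸ j
            o∸1≡ : o ∸ 1 ≡ j + u
            o∸1≡ = sym (m+[n∸m]≡n (m+n≤o⇒m≤o∸n j (subst (_≤ o) (+-comm 1 j) j<o)))
            u<kids : u < labelCount kids
            u<kids = +-cancelˡ-< j u (labelCount kids)
                       (subst (_< j + labelCount kids) o∸1≡ (<-≤-trans (∸-monoʳ-< {o = 0} (s≤s z≤n) 1≤offset) offset≤))
            leaf-node = nth-labelsOf-fullLeaves full-leaves after u<kids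
            y = proj₁ leaf-node
            node≡ : labelNode n ≡ just y
            node≡ = trans labelNode-n (trans (cong (nth (labelsOf (B ++ after))) o∸1≡)
                      (trans (nth-replicate-++ʳ j (reg i q) (labelsOf (kids ++ after)) u) (proj₁ (proj₂ leaf-node))))
            leafLabel : LeafLabel n
            leafLabel = subst T (sym (trans (cong (maybe isLeafK false) node≡) (proj₂ (proj₂ leaf-node)))) tt
            ¬penultLabel : ¬ PenultLabel n
            ¬penultLabel = subst T (trans (cong (maybe isPenultK false) node≡) (leaf⇒¬penult y (proj₂ (proj₂ leaf-node))))
            Δ<kj : Δ < k * j
            Δ<kj = subst (Δ <_) (sym kj≡w∸j) (∸-monoʳ-< j<o o≤w)
            kind : Δ > 0 → ((Δ < k * j) ⇔ LeafLabel n) × ((k * j ≤ Δ) ⇔ PenultLabel n)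
            kind _ = mk⇔ (λ _ → leafLabel) (λ _ → Δ<kj) , mk⇔ (λ kj≤Δ → ⊥-elim (<⇒≱ Δ<kj kj≤Δ)) (λ pen → ⊥-elim (¬penultLabel pen))
            Tl = (reg i q , j) ∷ prefixFrom (o ∸ j) (kids ++ after)
            𝒦≡ : 𝒦[ n ] ≡ whole X ++ Tl
            𝒦≡ = trans (cong 𝒦[_] n≡') (trans (𝒦-at 1≤offset o≤w) (cong (whole X ++_) (prefixFrom-covers (reg i q) (kids ++ after) 1≤offset (<⇒≤ j<o))))
            open Counting before Tl before-blocks 𝒦≡
            kids-prefix = prefixFrom-fullLeaves full-leaves after (m≤n+o⇒m∸n≤o o j offset≤)
            -- The leaf labels of 𝒦(n) in this family and the missing ones Δ fill up the k j labels of its leaves.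
            surplus : k * PT ≡ LT + Δ
            surplus = begin
              k * PT                    ≡⟨ cong (k *_) (cong₂ _+_ (keptPart-penult-reg i q j penult) (proj₂ kids-prefix)) ⟩
              k * (j + 0)               ≡⟨ cong (k *_) (+-identityʳ j) ⟩
              k * j                     ≡⟨ kj≡w∸j ⟩
              w ∸ j                     ≡⟨ sym (∸-telescope (<⇒≤ j<o) o≤w) ⟩
              (o ∸ j) + Δ               ≡⟨ cong (λ a → a + Δ) (sym (cong₂ _+_ (leafPart-nonleaf (reg i q) j (penult⇒¬leaf (reg i q) penult)) (proj₁ kids-prefix))) ⟩
              LT + Δ                    ∎
              where open ≡-Reasoning

        conclusion : Conclusion
        conclusion with o ≤? j
        ... | yes o≤j = in-penultimate o≤j
        ... | no o≰j = in-leaf (≰⇒> o≰j)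

      conclusion : Conclusion
      conclusion with position
      ... | inj₁ pos = at-interior pos
      ... | inj₂ pos = Family.conclusion pos

open import Data.Integer using (+_; _-_) renaming (_*_ to _*ℤ_; _+_ to _+ℤ_)
open import Function.Bundles using (_⇔_)

lemma3 : (k j s : ℕ) (𝒯 : Tree) → 1 ≤ k → 1 ≤ j → 2 ≤ height 𝒯 →
    let open Construction k j s 𝒯 in
    ∀ n → N (p + 1) < n →
      ((¬ LeafLabel n → ¬ PenultLabel n → Complete n)
        × ∃ (λ d → IsΔ n d × d < (k + 1) * j))
      × (∀ d → IsΔ n d → d > 0 →
           ((d < k * j) ⇔ LeafLabel n) × ((k * j ≤ d) ⇔ PenultLabel n))
      × (∀ d → IsΔ n d → d ≤ k * j →
           + k *ℤ + 𝒫R n ≡ (+ R n +ℤ + d) - ν)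
      × (∀ d → IsΔ n d → d > k * j →
           + k *ℤ + 𝒫R n ≡ ((+ R n +ℤ + (k * j)) - ν) - + k *ℤ (+ d - + (k * j)))
lemma3 (suc k') (suc j') s 𝒯 _ _ 2≤p n N<n = Analysis.Main.conclusion k' j' s 𝒯 2≤p n N<n
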